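{- Let $a,m$ be positive integers with $a<m$, let $\tau$ be any arrangement of the numbers $a+2,\dots,m+1$, and let $p=1\,2\cdots a\;\tau\;(a+1)\in S_{m+1}$ (the permutation starting with $1,2,\dots,a$, followed by $\tau$, followed by $a+1$). Then for every $k\ge 1$ the number of $k$-clusters relative to $P=\{p\}$ equals $$\prod_{j=1}^{k}\binom{jm-a}{m-a}.$$
   Context: A permutation of length $n$ is a sequence containing each of $1,\dots,n$ exactly once; $S_n$ is the set of these. For a sequence $s$ of distinct integers, $\mathrm{st}(s)$ is the unique permutation with the same relative order of entries. For a set $P$ of patterns, a $q$-cluster ($q\ge1$) is a tuple $(\sigma,\pi_1,\dots,\pi_q,i_1,\dots,i_q)$ where $\sigma$ is a permutation of some length $n$, $\pi_1,\dots,\pi_q\in P$ with lengths $r_1,\dots,r_q$, and positions $i_1,\dots,i_q$ satisfy: $\mathrm{st}(\sigma_{i_k}\sigma_{i_k+1}\cdots\sigma_{i_k+r_k-1})=\pi_k$ for each $k$; $i_k<i_{k+1}<i_k+r_k$ for each $k<q$; $i_1=1$ and $n=i_q+r_q-1$. The number of $k$-clusters is the number of such tuples. -}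

module Defs where

open import Data.Nat using (ℕ; zero; suc; _+_; _*_; _∸_; _≤_; _<_; _<ᵇ_; _≡ᵇ_)
open import Data.Bool using (Bool; true; false; if_then_else_)
open import Data.List using (List; []; _∷_; length; map; take; drop; upTo; _++_; [_])
open import Data.Nat.ListAction using (product)
open import Data.List.Relation.Unary.All using (All)
open import Data.List.Membership.Propositional using (_∈_)
open import Data.Product using (Σ; _×_; _,_)
open import Data.Empty using (⊥)
open import Data.Nat.Combinatorics using (_C_)
open import Relation.Binary.PropositionalEquality using (_≡_)

countᵇ : (ℕ → Bool) → List ℕ → ℕ
countᵇ f [] = 0
countᵇ f (x ∷ xs) = if f x then suc (countᵇ f xs) else countᵇ f xs

oneTo : ℕ → List ℕ
oneTo n = map suc (upTo n)

IsPerm : ℕ → List ℕ → Set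
IsPerm n σ = (length σ ≡ n) × All (λ j → countᵇ (_≡ᵇ j) σ ≡ 1) (oneTo n)

-- standardization: each entry x is replaced by 1 + #{entries smaller than x}
-- (for a sequence of distinct integers this is the unique permutation with
--  the same relative order)
st : List ℕ → List ℕ
st s = map (λ x → suc (countᵇ (_<ᵇ x) s)) s

-- the factor σ_i σ_{i+1} ... σ_{i+r-1}  (1-indexed position i)
window : List ℕ → ℕ → ℕ → List ℕ
window σ i r = take r (drop (i ∸ 1) σ)

Chain : List (List ℕ × ℕ) → ℕ → Set
Chain [] n = ⊥
Chain ((π , i) ∷ []) n = n ≡ i + length π ∸ 1
Chain ((π , i) ∷ (π′ , i′) ∷ rest) n =
  (i < i′) × (i′ < i + length π) × Chain ((π′ , i′) ∷ rest) n

StartsAt1 : List (List ℕ × ℕ) → Set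
StartsAt1 [] = ⊥
StartsAt1 ((π , i) ∷ _) = i ≡ 1

Occurs : List (List ℕ) → List ℕ → List ℕ × ℕ → Set
Occurs P σ (π , i) = (π ∈ P) × (st (window σ i (length π)) ≡ π)

-- the set of q-clusters (σ, π_1..π_q, i_1..i_q) relative to the pattern set P;
-- the list occs = [(π_1,i_1),...,(π_q,i_q)] encodes patterns and positions
Cluster : List (List ℕ) → ℕ → Set
Cluster P q =
  Σ ℕ λ n → Σ (List ℕ) λ σ → IsPerm n σ ×
  Σ (List (List ℕ × ℕ)) λ occs →
    (length occs ≡ q) × All (Occurs P σ) occs × StartsAt1 occs × Chain occs n

pat : ℕ → List ℕ → List ℕ
pat a τ = oneTo a ++ τ ++ [ suc a ]

range : ℕ → ℕ → List ℕ
range a m = map (λ i → a + 2 + i) (upTo (m ∸ a))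

clusterCount : ℕ → ℕ → ℕ → ℕ
clusterCount a m k = product (map (λ j → (j * m ∸ a) C (m ∸ a)) (oneTo k))

-- The proof follows the combinatorial argument of the paper.
--  (1) No self-overlap: two occurrences of p can never start at distance δ
--      with 0 < δ < m.  Hence in a k-cluster consecutive occurrences sit at
--      distance exactly m, the positions are forced to be 1, 1+m, …, 1+(k-1)m,
--      and a k-cluster is the same thing as a "good" permutation of length
--      km+1 carrying p at these k positions.
--  (2) A good permutation σ of length (k+1)m+1 splits as σ = α β with |α| = m.
--      The window α (head β) is an occurrence of p and head β is the minimum of
--      β, which forces α ⊇ {1,…,a}, a+1 ∉ α and head β = a+1.  So σ is
--      determined by the set α ∖ {1,…,a}, an (m-a)-subset of {a+2,…,N}, i.e.
--      a bit string of length (k+1)m-a with m-a ones, together with the good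
--      permutation st(β) of length km+1; this correspondence is a bijection.
--  (3) Bit strings of length n with r ones are counted by n C r, so by
--      induction the good permutations are counted by ∏ (jm-a) C (m-a).
module Submission where

open import Defs
open import Axiom.UniquenessOfIdentityProofs.WithK using (uip)
open import Data.Bool using (Bool; true; false; not)
open import Data.Bool.Properties using (T-≡; not-¬) renaming (_≟_ to _≟ᵇ_)
open import Data.Empty using (⊥; ⊥-elim)
open import Data.Fin using (Fin) renaming (zero to fzero; suc to fsuc)
open import Data.Fin.Properties using (+↔⊎; *↔×)
open import Data.List using (List; []; _∷_; [_]; length; map; take; drop; upTo; _++_; replicate; filter)
open import Data.List.Membership.Propositional using (_∈_; _∉_)
open import Data.List.Membership.Propositional.Properties using (∈-∃++; ∈-map⁻; ∈-map⁺; ∈-++⁻; ∈-++⁺ˡ; ∈-++⁺ʳ)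
open import Data.List.Properties using (map-upTo; upTo-∷ʳ; map-++; length-map; length-++; map-∘; map-cong; ++-assoc; take-map; drop-map; take++drop≡id; drop-drop; length-drop; length-take; length-replicate; ∷ʳ-injective; map-id; map-id-local; map-cong-local; length-upTo; ++-identityʳ; ∷-injectiveˡ; filter-++; filter-all; filter-none)
open import Data.List.Relation.Binary.Permutation.Propositional using (_↭_; module PermutationReasoning; prep; swap; ↭-sym; ↭-refl; ↭-trans) renaming (refl to ↭-base; trans to ↭-step)
open import Data.List.Relation.Binary.Permutation.Propositional.Properties using (map⁺; ++⁺; ++⁺ˡ; ++⁺ʳ; ↭-length; ∈-resp-↭; shift; ∷↭∷ʳ; filter-↭; ↭-singleton-inv)
open import Data.List.Relation.Unary.All as All using (All; []; _∷_)
import Data.List.Relation.Unary.All.Properties as All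
open import Data.List.Relation.Unary.Any using (here; there)
open import Data.Nat using (ℕ; zero; suc; _+_; _*_; _∸_; _≤_; _<_; _<ᵇ_; _≡ᵇ_; z≤n; s≤s; pred; _⊓_; _<?_; _≤?_)
open import Data.Nat.Combinatorics using (_C_; nCk+nC[k+1]≡[n+1]C[k+1])
open import Data.Nat.ListAction using (product)
open import Data.Nat.ListAction.Properties using (product-++)
import Data.Nat.Properties as ℕ
open import Data.Nat.Properties using (1+n≢0; <-trans; ≤-refl; ≤-trans; <-irrefl; ≤-antisym; <⇒≤; +-comm; +-assoc; +-suc; +-identityʳ; *-identityʳ; m≤m+n; ≤-pred; m+[n∸m]≡n; m+n∸m≡n; <-cmp; suc-injective; n≤1+n; m≤n⇒m≤1+n; m≤n⇒m⊓n≡m; +-cancelˡ-≡; +-cancelˡ-<; +-mono-≤; ≮⇒≥; <⇒≱; ≰⇒>; <-asym; m≤n⇒∃[o]m+o≡n; m<n+m; ≤-irrelevant)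
open import Data.Product using (Σ; _×_; _,_; proj₁; proj₂; ∃; ∃₂)
open import Data.Sum using (_⊎_; inj₁; inj₂; [_,_]′)
open import Data.Sum.Function.Propositional using (_⊎-↔_)
open import Data.Product.Function.NonDependent.Propositional using (_×-↔_)
open import Data.Unit using (⊤; tt)
open import Function using (_∘_; id)
open import Function.Bundles using (_↔_; mk↔ₛ′; Equivalence)
open import Function.Properties.Inverse using (↔-trans; ↔-sym; ↔-refl)
open import Relation.Binary.Definitions using (tri<; tri≈; tri>)
open import Relation.Binary.PropositionalEquality using (_≡_; _≢_; refl; sym; trans; cong; cong₂; subst; subst₂; module ≡-Reasoning)
open import Relation.Nullary using (yes; no; does)
open import Relation.Nullary.Decidable using (dec-true; dec-false)
open import Data.List.Membership.DecPropositional ℕ._≟_ using (_∈?_)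

true≢false : true ≢ false
true≢false ()

<ᵇ⇒< : ∀ x y → (x <ᵇ y) ≡ true → x < y
<ᵇ⇒< x y e = ℕ.<ᵇ⇒< x y (Equivalence.from T-≡ e)

<⇒<ᵇ : ∀ {x y} → x < y → (x <ᵇ y) ≡ true
<⇒<ᵇ x<y = Equivalence.to T-≡ (ℕ.<⇒<ᵇ x<y)

≥⇒<ᵇ-false : ∀ {x y} → y ≤ x → (x <ᵇ y) ≡ false
≥⇒<ᵇ-false {x} {y} y≤x with x <ᵇ y in e
... | true = ⊥-elim (<⇒≱ (<ᵇ⇒< x y e) y≤x)
... | false = refl

≡ᵇ⇒≡ : ∀ x y → (x ≡ᵇ y) ≡ true → x ≡ y
≡ᵇ⇒≡ x y e = ℕ.≡ᵇ⇒≡ x y (Equivalence.from T-≡ e)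

≡ᵇ-refl : ∀ x → (x ≡ᵇ x) ≡ true
≡ᵇ-refl x = Equivalence.to T-≡ (ℕ.≡⇒≡ᵇ x x refl)

≢⇒≡ᵇ-false : ∀ {x y} → x ≢ y → (x ≡ᵇ y) ≡ false
≢⇒≡ᵇ-false {x} {y} ne with x ≡ᵇ y in e
... | true = ⊥-elim (ne (≡ᵇ⇒≡ x y e))
... | false = refl

count-++ : ∀ (f : ℕ → Bool) xs ys → countᵇ f (xs ++ ys) ≡ countᵇ f xs + countᵇ f ys
count-++ f [] ys = refl
count-++ f (x ∷ xs) ys with f x
... | true = cong suc (count-++ f xs ys)
... | false = count-++ f xs ys

count-↭ : ∀ (f : ℕ → Bool) {xs ys} → xs ↭ ys → countᵇ f xs ≡ countᵇ f ys
count-↭ f ↭-base = refl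
count-↭ f (prep x p) with f x
... | true = cong suc (count-↭ f p)
... | false = count-↭ f p
count-↭ f (swap x y p) with f x | f y
... | true | true = cong (suc ∘ suc) (count-↭ f p)
... | true | false = cong suc (count-↭ f p)
... | false | true = cong suc (count-↭ f p)
... | false | false = count-↭ f p
count-↭ f (↭-step p q) = trans (count-↭ f p) (count-↭ f q)

count-false : ∀ xs → countᵇ (λ _ → false) xs ≡ 0
count-false [] = refl
count-false (x ∷ xs) = count-false xs

count-skip : ∀ (f : ℕ → Bool) {x} xs → f x ≡ false → countᵇ f (x ∷ xs) ≡ countᵇ f xs
count-skip f xs fx rewrite fx = refl

count≡0⇒false : ∀ (f : ℕ → Bool) xs → countᵇ f xs ≡ 0 → ∀ {y} → y ∈ xs → f y ≡ false
count≡0⇒false f (x ∷ xs) c0 (here refl) with f x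
... | true = ⊥-elim (1+n≢0 c0)
... | false = refl
count≡0⇒false f (x ∷ xs) c0 (there y∈xs) with f x
... | true = ⊥-elim (1+n≢0 c0)
... | false = count≡0⇒false f xs c0 y∈xs

all-false⇒count≡0 : ∀ (f : ℕ → Bool) xs → All (λ y → f y ≡ false) xs → countᵇ f xs ≡ 0
all-false⇒count≡0 f [] [] = refl
all-false⇒count≡0 f (y ∷ xs) (e ∷ es) rewrite e = all-false⇒count≡0 f xs es

count-pos : ∀ (f : ℕ → Bool) {xs y} → y ∈ xs → f y ≡ true → 1 ≤ countᵇ f xs
count-pos f {x ∷ xs} (here refl) e rewrite e = s≤s z≤n
count-pos f {x ∷ xs} (there y∈xs) e with f x
... | true = s≤s z≤n
... | false = count-pos f y∈xs e

count-pos⇒witness : ∀ (f : ℕ → Bool) xs → 1 ≤ countᵇ f xs → ∃ λ y → y ∈ xs × f y ≡ true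
count-pos⇒witness f (x ∷ xs) pos with f x in e
... | true = x , here refl , e
... | false with count-pos⇒witness f xs pos
...   | y , y∈xs , fy = y , there y∈xs , fy

countBelow-mono : ∀ {x y} → y ≤ x → ∀ xs → countᵇ (_<ᵇ y) xs ≤ countᵇ (_<ᵇ x) xs
countBelow-mono le [] = z≤n
countBelow-mono {x} {y} le (z ∷ xs) with z <ᵇ y in e₁ | z <ᵇ x in e₂
... | true | true = s≤s (countBelow-mono le xs)
... | true | false = ⊥-elim (true≢false (trans (sym (<⇒<ᵇ (≤-trans (<ᵇ⇒< z y e₁) le))) e₂))
... | false | true = ≤-trans (countBelow-mono le xs) (n≤1+n _)
... | false | false = countBelow-mono le xs

count-map : ∀ (g h : ℕ → Bool) (f : ℕ → ℕ) → (∀ y → g (f y) ≡ h y) → ∀ xs → countᵇ g (map f xs) ≡ countᵇ h xs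
count-map g h f gf≡h [] = refl
count-map g h f gf≡h (y ∷ xs) rewrite gf≡h y with h y
... | true = cong suc (count-map g h f gf≡h xs)
... | false = count-map g h f gf≡h xs

take-++-length : ∀ {A : Set} (xs ys : List A) {n} → length xs ≡ n → take n (xs ++ ys) ≡ xs
take-++-length [] ys refl = refl
take-++-length (x ∷ xs) ys refl = cong (x ∷_) (take-++-length xs ys refl)

drop-++-length : ∀ {A : Set} (xs ys : List A) {n} → length xs ≡ n → drop n (xs ++ ys) ≡ ys
drop-++-length [] ys refl = refl
drop-++-length (x ∷ xs) ys refl = drop-++-length xs ys refl

take-suc-++ : ∀ {A : Set} (xs ys : List A) {n} → length xs ≡ n → take (suc n) (xs ++ ys) ≡ xs ++ take 1 ys
take-suc-++ [] ys refl = refl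
take-suc-++ (x ∷ xs) ys refl = cong (x ∷_) (take-suc-++ xs ys refl)

take-suc : ∀ {A : Set} n (xs : List A) → take (suc n) xs ≡ take n xs ++ take 1 (drop n xs)
take-suc zero xs = refl
take-suc (suc n) [] = refl
take-suc (suc n) (x ∷ xs) = cong (x ∷_) (take-suc n xs)

∈-take⊎drop : ∀ {A : Set} n (xs : List A) {y} → y ∈ xs → y ∈ take n xs ⊎ y ∈ drop n xs
∈-take⊎drop n xs y∈ = ∈-++⁻ (take n xs) (subst (_ ∈_) (sym (take++drop≡id n xs)) y∈)

map-all-true : ∀ (P : ℕ → Bool) xs → All (λ y → P y ≡ true) xs → map P xs ≡ replicate (length xs) true
map-all-true P [] [] = refl
map-all-true P (y ∷ xs) (Py ∷ Pxs) = cong₂ _∷_ Py (map-all-true P xs Pxs)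

≡⇒↭ : ∀ {xs ys : List ℕ} → xs ≡ ys → xs ↭ ys
≡⇒↭ refl = ↭-refl

oneTo-suc : ∀ n → oneTo (suc n) ≡ 1 ∷ map suc (oneTo n)
oneTo-suc n = cong (λ l → 1 ∷ map suc l) (sym (map-upTo suc n))

oneTo-snoc : ∀ n → oneTo (suc n) ≡ oneTo n ++ [ suc n ]
oneTo-snoc n = trans (cong (map suc) (sym (upTo-∷ʳ n))) (map-++ suc (upTo n) [ n ])

oneTo-+ : ∀ s e → oneTo (s + e) ≡ oneTo s ++ map (λ i → suc (s + i)) (upTo e)
oneTo-+ zero e = refl
oneTo-+ (suc s) e = begin
  oneTo (suc s + e)                                                   ≡⟨ oneTo-suc (s + e) ⟩
  1 ∷ map suc (oneTo (s + e))                                         ≡⟨ cong (λ l → 1 ∷ map suc l) (oneTo-+ s e) ⟩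
  1 ∷ map suc (oneTo s ++ map (λ i → suc (s + i)) (upTo e))           ≡⟨ cong (1 ∷_) (map-++ suc (oneTo s) _) ⟩
  1 ∷ map suc (oneTo s) ++ map suc (map (λ i → suc (s + i)) (upTo e)) ≡⟨ cong (λ l → 1 ∷ map suc (oneTo s) ++ l) (sym (map-∘ (upTo e))) ⟩
  1 ∷ map suc (oneTo s) ++ map (λ i → suc (suc s + i)) (upTo e)       ≡⟨ cong (_++ map (λ i → suc (suc s + i)) (upTo e)) (sym (oneTo-suc s)) ⟩
  oneTo (suc s) ++ map (λ i → suc (suc s + i)) (upTo e)               ∎
  where open ≡-Reasoning

length-oneTo : ∀ n → length (oneTo n) ≡ n
length-oneTo n = trans (length-map suc (upTo n)) (length-upTo n)

∈-oneTo⁻ : ∀ {n x} → x ∈ oneTo n → 1 ≤ x × x ≤ n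
∈-oneTo⁻ {suc n} {x} x∈ rewrite oneTo-suc n with x∈
... | here refl = s≤s z≤n , s≤s z≤n
... | there x∈' with ∈-map⁻ suc x∈'
...   | y , y∈ , refl = s≤s z≤n , s≤s (proj₂ (∈-oneTo⁻ {n} y∈))

∈-oneTo⁺ : ∀ {n x} → 1 ≤ x → x ≤ n → x ∈ oneTo n
∈-oneTo⁺ {suc n} {suc zero} _ _ rewrite oneTo-suc n = here refl
∈-oneTo⁺ {suc n} {suc (suc x)} _ (s≤s le) rewrite oneTo-suc n = there (∈-map⁺ suc (∈-oneTo⁺ {n} (s≤s z≤n) le))

0∉oneTo : ∀ {n} → 0 ∉ oneTo n
0∉oneTo 0∈ with () ← proj₁ (∈-oneTo⁻ 0∈)

oneTo-head : ∀ {n} → 1 ≤ n → ∃ λ q → oneTo n ≡ 1 ∷ q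
oneTo-head {suc n} _ = map suc (oneTo n) , oneTo-suc n

take-oneTo : ∀ s e → take s (oneTo (s + e)) ≡ oneTo s
take-oneTo s e = trans (cong (take s) (oneTo-+ s e)) (take-++-length (oneTo s) _ (length-oneTo s))

countBelow-oneTo : ∀ r j → j ≤ r → countᵇ (_<ᵇ suc j) (oneTo r) ≡ j
countBelow-oneTo zero zero _ = refl
countBelow-oneTo (suc r) zero _ = begin
  countᵇ (_<ᵇ 1) (oneTo (suc r))         ≡⟨ cong (countᵇ (_<ᵇ 1)) (oneTo-suc r) ⟩
  countᵇ (_<ᵇ 1) (map suc (oneTo r))     ≡⟨ count-map (_<ᵇ 1) (λ _ → false) suc (λ _ → refl) (oneTo r) ⟩
  countᵇ (λ _ → false) (oneTo r)         ≡⟨ count-false (oneTo r) ⟩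
  0                                      ∎
  where open ≡-Reasoning
countBelow-oneTo (suc r) (suc j) (s≤s j≤r) = begin
  countᵇ (_<ᵇ suc (suc j)) (oneTo (suc r))            ≡⟨ cong (countᵇ (_<ᵇ suc (suc j))) (oneTo-suc r) ⟩
  suc (countᵇ (_<ᵇ suc (suc j)) (map suc (oneTo r)))  ≡⟨ cong suc (count-map _ (_<ᵇ suc j) suc (λ _ → refl) (oneTo r)) ⟩
  suc (countᵇ (_<ᵇ suc j) (oneTo r))                  ≡⟨ cong suc (countBelow-oneTo r j j≤r) ⟩
  suc j                                               ∎
  where open ≡-Reasoning

rank-oneTo : ∀ {n x} → x ∈ oneTo n → suc (countᵇ (_<ᵇ x) (oneTo n)) ≡ x
rank-oneTo {n} {suc j} x∈ = cong suc (countBelow-oneTo n j (≤-pred (m≤n⇒m≤1+n (proj₂ (∈-oneTo⁻ x∈)))))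
rank-oneTo {x = zero} x∈ = ⊥-elim (0∉oneTo x∈)

countEq-oneTo : ∀ r j → j < r → countᵇ (_≡ᵇ suc j) (oneTo r) ≡ 1
countEq-oneTo (suc r) zero _ = begin
  countᵇ (_≡ᵇ 1) (oneTo (suc r))          ≡⟨ cong (countᵇ (_≡ᵇ 1)) (oneTo-suc r) ⟩
  suc (countᵇ (_≡ᵇ 1) (map suc (oneTo r))) ≡⟨ cong suc (count-map (_≡ᵇ 1) (_≡ᵇ 0) suc (λ _ → refl) (oneTo r)) ⟩
  suc (countᵇ (_≡ᵇ 0) (map suc (upTo r)))  ≡⟨ cong suc (count-map (_≡ᵇ 0) (λ _ → false) suc (λ _ → refl) (upTo r)) ⟩
  suc (countᵇ (λ _ → false) (upTo r))      ≡⟨ cong suc (count-false (upTo r)) ⟩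
  1                                        ∎
  where open ≡-Reasoning
countEq-oneTo (suc r) (suc j) (s≤s j<r) = begin
  countᵇ (_≡ᵇ suc (suc j)) (oneTo (suc r))        ≡⟨ cong (countᵇ (_≡ᵇ suc (suc j))) (oneTo-suc r) ⟩
  countᵇ (_≡ᵇ suc (suc j)) (map suc (oneTo r))    ≡⟨ count-map _ (_≡ᵇ suc j) suc (λ _ → refl) (oneTo r) ⟩
  countᵇ (_≡ᵇ suc j) (oneTo r)                    ≡⟨ countEq-oneTo r j j<r ⟩
  1                                               ∎
  where open ≡-Reasoning

↭⇒IsPerm : ∀ n σ → σ ↭ oneTo n → IsPerm n σ
↭⇒IsPerm n σ σ↭ = trans (↭-length σ↭) (length-oneTo n) , All.tabulate once
  where
  once : ∀ {j} → j ∈ oneTo n → countᵇ (_≡ᵇ j) σ ≡ 1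
  once {suc j} j∈ = trans (count-↭ (_≡ᵇ suc j) σ↭) (countEq-oneTo n j (proj₂ (∈-oneTo⁻ j∈)))
  once {zero} j∈ = ⊥-elim (0∉oneTo j∈)

-- Remove the largest entry n+1 from σ and use induction on n.
IsPerm⇒↭ : ∀ n σ → IsPerm n σ → σ ↭ oneTo n
IsPerm⇒↭ zero [] _ = ↭-refl
IsPerm⇒↭ (suc n) σ (len , once) = begin
  σ                         ≡⟨ σ≡ ⟩
  xs ++ [ top ] ++ ys       ↭⟨ shift top xs ys ⟩
  top ∷ xs ++ ys            ↭⟨ prep top (IsPerm⇒↭ n (xs ++ ys) (len₀ , once₀)) ⟩
  top ∷ oneTo n             ≡⟨ cong (_∷ oneTo n) top≡ ⟩
  suc n ∷ oneTo n           ↭⟨ ∷↭∷ʳ (suc n) (oneTo n) ⟩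
  oneTo n ++ [ suc n ]      ≡⟨ sym (oneTo-snoc n) ⟩
  oneTo (suc n)             ∎
  where
  open PermutationReasoning
  Once : ℕ → Set
  Once j = countᵇ (_≡ᵇ j) σ ≡ 1
  once-split : All Once (oneTo n) × All Once [ suc n ]
  once-split = All.++⁻ (oneTo n) (subst (All Once) (oneTo-snoc n) once)
  top-occurs : ∃ λ y → y ∈ σ × (y ≡ᵇ suc n) ≡ true
  top-occurs = count-pos⇒witness (_≡ᵇ suc n) σ (subst (1 ≤_) (sym (All.head (proj₂ once-split))) ≤-refl)
  top = proj₁ top-occurs
  top≡ : top ≡ suc n
  top≡ = ≡ᵇ⇒≡ top (suc n) (proj₂ (proj₂ top-occurs))
  decomposition : ∃₂ λ xs ys → σ ≡ xs ++ [ top ] ++ ys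
  decomposition = ∈-∃++ (proj₁ (proj₂ top-occurs))
  xs = proj₁ decomposition
  ys = proj₁ (proj₂ decomposition)
  σ≡ = proj₂ (proj₂ decomposition)
  len₀ : length (xs ++ ys) ≡ n
  len₀ = suc-injective (trans (sym (↭-length (shift top xs ys))) (trans (cong length (sym σ≡)) len))
  once₀ : All (λ j → countᵇ (_≡ᵇ j) (xs ++ ys) ≡ 1) (oneTo n)
  once₀ = All.tabulate λ {j} j∈ →
    let top≢j : (top ≡ᵇ j) ≡ false
        top≢j = ≢⇒≡ᵇ-false (λ e → <-irrefl refl (subst (_≤ n) (trans (sym e) top≡) (proj₂ (∈-oneTo⁻ j∈))))
        with-top : countᵇ (_≡ᵇ j) (top ∷ xs ++ ys) ≡ 1
        with-top = trans (sym (count-↭ (_≡ᵇ j) (shift top xs ys))) (trans (cong (countᵇ (_≡ᵇ j)) (sym σ≡)) (All.lookup (proj₁ once-split) j∈))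
    in trans (sym (count-skip (_≡ᵇ j) {top} (xs ++ ys) top≢j)) with-top

IsPerm-disjoint : ∀ n α β → IsPerm n (α ++ β) → ∀ {x} → x ∈ α → x ∈ β → ⊥
IsPerm-disjoint n α β (len , once) {x} x∈α x∈β = <-irrefl refl (subst (2 ≤_) once-x twice)
  where
  x∈oneTo : x ∈ oneTo n
  x∈oneTo = ∈-resp-↭ (IsPerm⇒↭ n (α ++ β) (len , once)) (∈-++⁺ˡ x∈α)
  once-x : countᵇ (_≡ᵇ x) (α ++ β) ≡ 1
  once-x = All.lookup once x∈oneTo
  twice : 2 ≤ countᵇ (_≡ᵇ x) (α ++ β)
  twice = subst (2 ≤_) (sym (count-++ (_≡ᵇ x) α β))
            (+-mono-≤ (count-pos (_≡ᵇ x) x∈α (≡ᵇ-refl x)) (count-pos (_≡ᵇ x) x∈β (≡ᵇ-refl x)))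

StrictMono : (ℕ → ℕ) → Set
StrictMono f = ∀ {x y} → x < y → f x < f y

id-mono : StrictMono id
id-mono x<y = x<y

<ᵇ-mono : ∀ {f} → StrictMono f → ∀ y x → (f y <ᵇ f x) ≡ (y <ᵇ x)
<ᵇ-mono {f} f-mono y x with <-cmp y x
... | tri< y<x _ _ = trans (<⇒<ᵇ (f-mono y<x)) (sym (<⇒<ᵇ y<x))
... | tri≈ _ refl _ = trans (≥⇒<ᵇ-false {f y} ≤-refl) (sym (≥⇒<ᵇ-false {y} ≤-refl))
... | tri> _ _ y>x = trans (≥⇒<ᵇ-false (<⇒≤ (f-mono y>x))) (sym (≥⇒<ᵇ-false (<⇒≤ y>x)))

countBelow-map : ∀ {f} → StrictMono f → ∀ x xs → countᵇ (_<ᵇ f x) (map f xs) ≡ countᵇ (_<ᵇ x) xs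
countBelow-map {f} f-mono x = count-map (_<ᵇ f x) (_<ᵇ x) f (λ y → <ᵇ-mono f-mono y x)

st-map : ∀ {f} → StrictMono f → ∀ s → st (map f s) ≡ st s
st-map {f} f-mono s = trans (sym (map-∘ s)) (map-cong (λ x → cong suc (countBelow-map f-mono x s)) s)

rank-image : ∀ {f} → StrictMono f → ∀ {s r} → s ↭ map f (oneTo r) → ∀ j → j < r → suc (countᵇ (_<ᵇ f (suc j)) s) ≡ suc j
rank-image {f} f-mono {s} {r} s↭ j j<r = cong suc (begin
  countᵇ (_<ᵇ f (suc j)) s                    ≡⟨ count-↭ (_<ᵇ f (suc j)) s↭ ⟩
  countᵇ (_<ᵇ f (suc j)) (map f (oneTo r))    ≡⟨ countBelow-map f-mono (suc j) (oneTo r) ⟩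
  countᵇ (_<ᵇ suc j) (oneTo r)                ≡⟨ countBelow-oneTo r j (<⇒≤ j<r) ⟩
  j                                           ∎)
  where open ≡-Reasoning

st-relabel : ∀ {f} → StrictMono f → ∀ {s r} → s ↭ map f (oneTo r) → map f (st s) ≡ s
st-relabel {f} f-mono {s} {r} s↭ = trans (sym (map-∘ s)) (map-id-local (All.tabulate f∘rank≡id))
  where
  f∘rank≡id : ∀ {x} → x ∈ s → f (suc (countᵇ (_<ᵇ x) s)) ≡ x
  f∘rank≡id x∈s with ∈-map⁻ f (∈-resp-↭ s↭ x∈s)
  ... | suc j , j∈ , refl = cong f (rank-image f-mono s↭ j (proj₂ (∈-oneTo⁻ j∈)))
  ... | zero , j∈ , refl = ⊥-elim (0∉oneTo j∈)

st-↭ : ∀ {f} → StrictMono f → ∀ {s r} → s ↭ map f (oneTo r) → st s ↭ oneTo r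
st-↭ {f} f-mono {s} {r} s↭ = ↭-trans (map⁺ rank s↭) (≡⇒↭ (trans (sym (map-∘ (oneTo r))) (map-id-local (All.tabulate rank∘f≡id))))
  where
  rank : ℕ → ℕ
  rank x = suc (countᵇ (_<ᵇ x) s)
  rank∘f≡id : ∀ {j} → j ∈ oneTo r → rank (f j) ≡ j
  rank∘f≡id {suc j} j∈ = rank-image f-mono s↭ j (proj₂ (∈-oneTo⁻ j∈))
  rank∘f≡id {zero} j∈ = ⊥-elim (0∉oneTo j∈)

st-id : ∀ {s r} → s ↭ oneTo r → st s ≡ s
st-id {s} {r} s↭ = trans (sym (map-id (st s))) (st-relabel id-mono (subst (s ↭_) (sym (map-id (oneTo r))) s↭))

-- Subsets of {1, …, n} coded by bit strings of length n.  select c j is the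
-- position of the j-th true bit of c (positions beyond c continue one by
-- one); it is strictly increasing, and chosen c lists the positions of the
-- true bits in increasing order.

select : List Bool → ℕ → ℕ
select c zero = zero
select [] (suc x) = suc x
select (true ∷ c) (suc x) = suc (select c x)
select (false ∷ c) (suc x) = suc (select c (suc x))

select-pos : ∀ c x → 1 ≤ select c (suc x)
select-pos [] x = s≤s z≤n
select-pos (true ∷ c) x = s≤s z≤n
select-pos (false ∷ c) x = s≤s z≤n

select-mono : ∀ c → StrictMono (select c)
select-mono c {zero} {suc y} _ = select-pos c y
select-mono [] {suc x} {suc y} x<y = x<y
select-mono (true ∷ c) {suc x} {suc y} (s≤s x<y) = s≤s (select-mono c x<y)
select-mono (false ∷ c) {suc x} {suc y} (s≤s x<y) = s≤s (select-mono c (s≤s x<y))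

trues : List Bool → ℕ
trues [] = 0
trues (true ∷ c) = suc (trues c)
trues (false ∷ c) = trues c

complement : List Bool → List Bool
complement = map not

trues-complement : ∀ c → trues c + trues (complement c) ≡ length c
trues-complement [] = refl
trues-complement (true ∷ c) = cong suc (trues-complement c)
trues-complement (false ∷ c) = trans (+-suc (trues c) (trues (complement c))) (cong suc (trues-complement c))

chosen : List Bool → List ℕ
chosen c = map (select c) (oneTo (trues c))

chosen-true : ∀ c → chosen (true ∷ c) ≡ 1 ∷ map suc (chosen c)
chosen-true c = trans (cong (map (select (true ∷ c))) (oneTo-suc (trues c))) (cong (1 ∷_) (shift-select (oneTo (trues c))))
  where
  shift-select : ∀ L → map (select (true ∷ c)) (map suc L) ≡ map suc (map (select c) L)
  shift-select [] = refl
  shift-select (x ∷ L) = cong (_ ∷_) (shift-select L)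

chosen-false : ∀ c → chosen (false ∷ c) ≡ map suc (chosen c)
chosen-false c = shift-select (upTo (trues c))
  where
  shift-select : ∀ L → map (select (false ∷ c)) (map suc L) ≡ map suc (map (select c) (map suc L))
  shift-select [] = refl
  shift-select (x ∷ L) = cong (_ ∷_) (shift-select L)

chosen-partition : ∀ c → chosen c ++ chosen (complement c) ↭ oneTo (length c)
chosen-partition [] = ↭-refl
chosen-partition (true ∷ c) = begin
  chosen (true ∷ c) ++ chosen (false ∷ complement c)       ≡⟨ cong₂ _++_ (chosen-true c) (chosen-false (complement c)) ⟩
  1 ∷ map suc (chosen c) ++ map suc (chosen (complement c)) ≡⟨ cong (1 ∷_) (sym (map-++ suc (chosen c) _)) ⟩
  1 ∷ map suc (chosen c ++ chosen (complement c))           ↭⟨ prep 1 (map⁺ suc (chosen-partition c)) ⟩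
  1 ∷ map suc (oneTo (length c))                            ≡⟨ sym (oneTo-suc (length c)) ⟩
  oneTo (suc (length c))                                    ∎
  where open PermutationReasoning
chosen-partition (false ∷ c) = begin
  chosen (false ∷ c) ++ chosen (true ∷ complement c)       ≡⟨ cong₂ _++_ (chosen-false c) (chosen-true (complement c)) ⟩
  map suc (chosen c) ++ 1 ∷ map suc (chosen (complement c)) ↭⟨ shift 1 (map suc (chosen c)) _ ⟩
  1 ∷ map suc (chosen c) ++ map suc (chosen (complement c)) ≡⟨ cong (1 ∷_) (sym (map-++ suc (chosen c) _)) ⟩
  1 ∷ map suc (chosen c ++ chosen (complement c))           ↭⟨ prep 1 (map⁺ suc (chosen-partition c)) ⟩
  1 ∷ map suc (oneTo (length c))                            ≡⟨ sym (oneTo-suc (length c)) ⟩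
  oneTo (suc (length c))                                    ∎
  where open PermutationReasoning

-- bit c v is the v-th bit of c (1-based), false outside 1, …, length c.
bit : List Bool → ℕ → Bool
bit [] _ = false
bit (x ∷ c) zero = false
bit (x ∷ c) (suc zero) = x
bit (x ∷ c) (suc (suc v)) = bit c (suc v)

bit-cons : ∀ x c v → 1 ≤ v → bit (x ∷ c) (suc v) ≡ bit c v
bit-cons x c (suc v) _ = refl

bit-select : ∀ c j → j < trues c → bit c (select c (suc j)) ≡ true
bit-select (true ∷ c) zero _ = refl
bit-select (true ∷ c) (suc j) (s≤s j<) = trans (bit-cons true c _ (select-pos c j)) (bit-select c j j<)
bit-select (false ∷ c) j j< = trans (bit-cons false c _ (select-pos c j)) (bit-select c j j<)

bit-complement : ∀ c v → 1 ≤ v → v ≤ length c → bit (complement c) v ≡ not (bit c v)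
bit-complement (x ∷ c) (suc zero) _ _ = refl
bit-complement (x ∷ c) (suc (suc v)) _ (s≤s v≤) = bit-complement c (suc v) (s≤s z≤n) v≤

map-oneTo-suc : ∀ (P : ℕ → Bool) n → map P (oneTo (suc n)) ≡ P 1 ∷ map (P ∘ suc) (oneTo n)
map-oneTo-suc P n = trans (cong (map P) (oneTo-suc n)) (cong (P 1 ∷_) (sym (map-∘ (oneTo n))))

bit-indicator : ∀ (P : ℕ → Bool) N v → 1 ≤ v → v ≤ N → bit (map P (oneTo N)) v ≡ P v
bit-indicator P (suc N) (suc zero) _ _ = cong (λ l → bit l 1) (map-oneTo-suc P N)
bit-indicator P (suc N) (suc (suc v)) _ (s≤s v≤) =
  trans (cong (λ l → bit l (suc (suc v))) (map-oneTo-suc P N)) (bit-indicator (P ∘ suc) N (suc v) (s≤s z≤n) v≤)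

indicator-bit : ∀ c → map (bit c) (oneTo (length c)) ≡ c
indicator-bit [] = refl
indicator-bit (x ∷ c) = trans (map-oneTo-suc (bit (x ∷ c)) (length c))
  (cong (x ∷_) (trans (map-cong-local (All.tabulate λ v∈ → bit-cons x c _ (proj₁ (∈-oneTo⁻ v∈)))) (indicator-bit c)))

chosen-range : ∀ c {v} → v ∈ chosen c → 1 ≤ v × v ≤ length c
chosen-range c v∈ = ∈-oneTo⁻ (∈-resp-↭ (chosen-partition c) (∈-++⁺ˡ v∈))

unchosen-range : ∀ c {v} → v ∈ chosen (complement c) → 1 ≤ v × v ≤ length c
unchosen-range c v∈ = ∈-oneTo⁻ (∈-resp-↭ (chosen-partition c) (∈-++⁺ʳ (chosen c) v∈))

chosen⇒bit : ∀ c {v} → v ∈ chosen c → bit c v ≡ true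
chosen⇒bit c v∈ with ∈-map⁻ (select c) v∈
... | suc j , j∈ , refl = bit-select c j (proj₂ (∈-oneTo⁻ j∈))
... | zero , j∈ , refl = ⊥-elim (0∉oneTo j∈)

unchosen⇒bit : ∀ c {v} → v ∈ chosen (complement c) → bit c v ≡ false
unchosen⇒bit c {v} v∈ with bit c v in e | unchosen-range c v∈
... | false | _ = refl
... | true | (1≤v , v≤) = ⊥-elim (true≢false (trans (sym (chosen⇒bit (complement c) v∈)) (trans (bit-complement c v 1≤v v≤) (cong not e))))

bit⇒chosen : ∀ c v → 1 ≤ v → v ≤ length c → bit c v ≡ true → v ∈ chosen c
bit⇒chosen c v 1≤v v≤ e with ∈-++⁻ (chosen c) (∈-resp-↭ (↭-sym (chosen-partition c)) (∈-oneTo⁺ 1≤v v≤))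
... | inj₁ v∈ = v∈
... | inj₂ v∈ = ⊥-elim (true≢false (trans (sym e) (unchosen⇒bit c v∈)))

memberᵇ : ℕ → List ℕ → Bool
memberᵇ x ys = does (x ∈? ys)

memberᵇ⇒∈ : ∀ x ys → memberᵇ x ys ≡ true → x ∈ ys
memberᵇ⇒∈ x ys e with x ∈? ys
... | yes x∈ = x∈
... | no _ = ⊥-elim (true≢false (sym e))

∈⇒memberᵇ : ∀ {x ys} → x ∈ ys → memberᵇ x ys ≡ true
∈⇒memberᵇ {x} {ys} = dec-true (x ∈? ys)

∉⇒memberᵇ : ∀ {x ys} → x ∉ ys → memberᵇ x ys ≡ false
∉⇒memberᵇ {x} {ys} = dec-false (x ∈? ys)

memberᵇ-↭ : ∀ x {xs ys} → xs ↭ ys → memberᵇ x xs ≡ memberᵇ x ys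
memberᵇ-↭ x {xs} {ys} xs↭ys with memberᵇ x xs in e₁ | memberᵇ x ys in e₂
... | true | true = refl
... | false | false = refl
... | true | false = trans (sym (∈⇒memberᵇ (∈-resp-↭ xs↭ys (memberᵇ⇒∈ x xs e₁)))) e₂
... | false | true = trans (sym e₁) (∈⇒memberᵇ (∈-resp-↭ (↭-sym xs↭ys) (memberᵇ⇒∈ x ys e₂)))

memberᵇ-chosen : ∀ c v → 1 ≤ v → v ≤ length c → memberᵇ v (chosen c) ≡ bit c v
memberᵇ-chosen c v 1≤v v≤ with bit c v in e
... | true = ∈⇒memberᵇ (bit⇒chosen c v 1≤v v≤ e)
... | false = ∉⇒memberᵇ (λ v∈ → true≢false (trans (sym (chosen⇒bit c v∈)) e))

-- A splitting of 1, …, N into disjoint lists α and β is coded by the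
-- indicator string of α: α and β rearrange its chosen and unchosen positions.
module Partition (N : ℕ) (α β : List ℕ) (α++β↭ : α ++ β ↭ oneTo N) (disjoint : ∀ {x} → x ∈ α → x ∈ β → ⊥) where
  inα : ℕ → Bool
  inα v = memberᵇ v α

  indicator : List Bool
  indicator = map inα (oneTo N)

  length-indicator : length indicator ≡ N
  length-indicator = trans (length-map inα (oneTo N)) (length-oneTo N)

  private
    bit≡inα : ∀ {v} → 1 ≤ v × v ≤ length indicator → bit indicator v ≡ inα v
    bit≡inα {v} (1≤v , v≤) = bit-indicator inα N v 1≤v (subst (v ≤_) length-indicator v≤)

    chosen⇒inα : ∀ {v} → v ∈ chosen indicator → inα v ≡ true
    chosen⇒inα v∈ = trans (sym (bit≡inα (chosen-range indicator v∈))) (chosen⇒bit indicator v∈)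

    unchosen⇒inα : ∀ {v} → v ∈ chosen (complement indicator) → inα v ≡ false
    unchosen⇒inα v∈ = trans (sym (bit≡inα (unchosen-range indicator v∈))) (unchosen⇒bit indicator v∈)

    β⇒inα : ∀ {v} → v ∈ β → inα v ≡ false
    β⇒inα v∈β = ∉⇒memberᵇ (λ v∈α → disjoint v∈α v∈β)

    parts↭ : chosen indicator ++ chosen (complement indicator) ↭ α ++ β
    parts↭ = ↭-trans (chosen-partition indicator) (subst (λ n → oneTo n ↭ α ++ β) (sym length-indicator) (↭-sym α++β↭))

    filter-left : ∀ {T : ℕ → Bool} xs ys → All (λ v → T v ≡ true) xs → All (λ v → T v ≡ false) ys → filter (λ v → T v ≟ᵇ true) (xs ++ ys) ≡ xs
    filter-left {T} xs ys pass fail = begin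
      filter T? (xs ++ ys)          ≡⟨ filter-++ T? xs ys ⟩
      filter T? xs ++ filter T? ys  ≡⟨ cong₂ _++_ (filter-all T? pass) (filter-none T? (All.map not-¬ fail)) ⟩
      xs ++ []                      ≡⟨ ++-identityʳ xs ⟩
      xs                            ∎
      where
      open ≡-Reasoning
      T? = λ v → T v ≟ᵇ true

    filter-right : ∀ {T : ℕ → Bool} xs ys → All (λ v → T v ≡ true) xs → All (λ v → T v ≡ false) ys → filter (λ v → T v ≟ᵇ false) (xs ++ ys) ≡ ys
    filter-right {T} xs ys pass fail = begin
      filter F? (xs ++ ys)          ≡⟨ filter-++ F? xs ys ⟩
      filter F? xs ++ filter F? ys  ≡⟨ cong₂ _++_ (filter-none F? (All.map not-¬ pass)) (filter-all F? fail) ⟩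
      ys                            ∎
      where
      open ≡-Reasoning
      F? = λ v → T v ≟ᵇ false

  α↭chosen : α ↭ chosen indicator
  α↭chosen = subst₂ _↭_
    (filter-left α β (All.tabulate ∈⇒memberᵇ) (All.tabulate β⇒inα))
    (filter-left (chosen indicator) _ (All.tabulate chosen⇒inα) (All.tabulate unchosen⇒inα))
    (filter-↭ (λ v → inα v ≟ᵇ true) (↭-sym parts↭))

  β↭unchosen : β ↭ chosen (complement indicator)
  β↭unchosen = subst₂ _↭_
    (filter-right α β (All.tabulate ∈⇒memberᵇ) (All.tabulate β⇒inα))
    (filter-right (chosen indicator) _ (All.tabulate chosen⇒inα) (All.tabulate unchosen⇒inα))
    (filter-↭ (λ v → inα v ≟ᵇ false) (↭-sym parts↭))

select-after-trues : ∀ a d x → select (replicate a true ++ d) (a + x) ≡ a + select d x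
select-after-trues zero d x = refl
select-after-trues (suc a) d x = cong suc (select-after-trues a d x)

select-within-trues : ∀ a d x → x ≤ a → select (replicate a true ++ d) x ≡ x
select-within-trues a d zero _ = refl
select-within-trues (suc a) d (suc x) (s≤s x≤a) = cong suc (select-within-trues a d x x≤a)

select-after-falses : ∀ a d x → select (replicate a false ++ d) (suc x) ≡ a + select d (suc x)
select-after-falses zero d x = refl
select-after-falses (suc a) d x = cong suc (select-after-falses a d x)

trues-after-trues : ∀ a d → trues (replicate a true ++ d) ≡ a + trues d
trues-after-trues zero d = refl
trues-after-trues (suc a) d = cong suc (trues-after-trues a d)

complement-after-trues : ∀ a x b → complement (replicate a true ++ x ∷ b) ≡ replicate a false ++ not x ∷ complement b
complement-after-trues zero x b = refl
complement-after-trues (suc a) x b = cong (false ∷_) (complement-after-trues a x b)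

drop-after-trues : ∀ a x (b : List Bool) → drop (suc a) (replicate a true ++ x ∷ b) ≡ b
drop-after-trues zero x b = refl
drop-after-trues (suc a) x b = drop-after-trues a x b

Bits : ℕ → ℕ → Set
Bits n r = Σ (List Bool) λ b → length b ≡ n × trues b ≡ r

Bits-≡ : ∀ {n r} {b b′ : List Bool} {u : length b ≡ n × trues b ≡ r} {v : length b′ ≡ n × trues b′ ≡ r} → b ≡ b′ → _≡_ {A = Bits n r} (b , u) (b′ , v)
Bits-≡ {u = u₁ , u₂} {v₁ , v₂} refl = cong (_ ,_) (cong₂ _,_ (uip u₁ v₁) (uip u₂ v₂))

Bits-suc-suc : ∀ n r → Bits (suc n) (suc r) ↔ (Bits n r ⊎ Bits n (suc r))
Bits-suc-suc n r = mk↔ₛ′ to from to∘from from∘to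
  where
  to : Bits (suc n) (suc r) → Bits n r ⊎ Bits n (suc r)
  to (true ∷ b , len , t) = inj₁ (b , suc-injective len , suc-injective t)
  to (false ∷ b , len , t) = inj₂ (b , suc-injective len , t)
  from : Bits n r ⊎ Bits n (suc r) → Bits (suc n) (suc r)
  from (inj₁ (b , len , t)) = true ∷ b , cong suc len , cong suc t
  from (inj₂ (b , len , t)) = false ∷ b , cong suc len , t
  to∘from : ∀ y → to (from y) ≡ y
  to∘from (inj₁ _) = cong inj₁ (Bits-≡ refl)
  to∘from (inj₂ _) = cong inj₂ (Bits-≡ refl)
  from∘to : ∀ x → from (to x) ≡ x
  from∘to (true ∷ b , _) = Bits-≡ refl
  from∘to (false ∷ b , _) = Bits-≡ refl

Bits-suc-zero : ∀ n → Bits (suc n) 0 ↔ Bits n 0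
Bits-suc-zero n = mk↔ₛ′ to from (λ _ → Bits-≡ refl) from∘to
  where
  to : Bits (suc n) 0 → Bits n 0
  to (false ∷ b , len , t) = b , suc-injective len , t
  from : Bits n 0 → Bits (suc n) 0
  from (b , len , t) = false ∷ b , cong suc len , t
  from∘to : ∀ x → from (to x) ≡ x
  from∘to (false ∷ b , _) = Bits-≡ refl

Fin-≡ : ∀ {x y} → x ≡ y → Fin x ↔ Fin y
Fin-≡ refl = ↔-refl

Bits↔binomial : ∀ n r → Bits n r ↔ Fin (n C r)
Bits↔binomial zero zero = mk↔ₛ′ (λ _ → fzero) (λ _ → [] , refl , refl) (λ { fzero → refl ; (fsuc ()) }) (λ { ([] , refl , refl) → refl })
Bits↔binomial zero (suc r) = mk↔ₛ′ (λ { ([] , _ , ()) }) (λ ()) (λ ()) (λ { ([] , _ , ()) })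
Bits↔binomial (suc n) zero = ↔-trans (Bits-suc-zero n) (Bits↔binomial n zero)
Bits↔binomial (suc n) (suc r) =
  ↔-trans (Bits-suc-suc n r)
  (↔-trans (Bits↔binomial n r ⊎-↔ Bits↔binomial n (suc r))
  (↔-trans (↔-sym +↔⊎) (Fin-≡ (nCk+nC[k+1]≡[n+1]C[k+1] n r))))

-- Entries by 0-based index (0 outside the list).

nth : List ℕ → ℕ → ℕ
nth [] _ = 0
nth (x ∷ xs) zero = x
nth (x ∷ xs) (suc j) = nth xs j

nth-map : ∀ (f : ℕ → ℕ) xs j → j < length xs → nth (map f xs) j ≡ f (nth xs j)
nth-map f (x ∷ xs) zero _ = refl
nth-map f (x ∷ xs) (suc j) (s≤s j<) = nth-map f xs j j<

nth-take : ∀ n xs j → j < n → nth (take n xs) j ≡ nth xs j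
nth-take (suc n) [] j _ = refl
nth-take (suc n) (x ∷ xs) zero _ = refl
nth-take (suc n) (x ∷ xs) (suc j) (s≤s j<) = nth-take n xs j j<

nth-drop : ∀ s xs j → nth (drop s xs) j ≡ nth xs (s + j)
nth-drop zero xs j = refl
nth-drop (suc s) [] j = refl
nth-drop (suc s) (x ∷ xs) j = nth-drop s xs j

nth-window : ∀ n s xs j → j < n → nth (take n (drop s xs)) j ≡ nth xs (s + j)
nth-window n s xs j j< = trans (nth-take n (drop s xs) j j<) (nth-drop s xs j)

nth-++ˡ : ∀ xs ys j → j < length xs → nth (xs ++ ys) j ≡ nth xs j
nth-++ˡ (x ∷ xs) ys zero _ = refl
nth-++ˡ (x ∷ xs) ys (suc j) (s≤s j<) = nth-++ˡ xs ys j j<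

nth-++ʳ : ∀ xs ys j → nth (xs ++ ys) (length xs + j) ≡ nth ys j
nth-++ʳ [] ys j = refl
nth-++ʳ (x ∷ xs) ys j = nth-++ʳ xs ys j

nth-∈ : ∀ xs j → j < length xs → nth xs j ∈ xs
nth-∈ (x ∷ xs) zero _ = here refl
nth-∈ (x ∷ xs) (suc j) (s≤s j<) = there (nth-∈ xs j j<)

nth-oneTo : ∀ n j → j < n → nth (oneTo n) j ≡ suc j
nth-oneTo (suc n) zero _ = cong (λ l → nth l 0) (oneTo-suc n)
nth-oneTo (suc n) (suc j) (s≤s j<n) = trans (cong (λ l → nth l (suc j)) (oneTo-suc n))
  (trans (nth-map suc (oneTo n) j (subst (j <_) (sym (length-oneTo n)) j<n)) (cong suc (nth-oneTo n j j<n)))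

st-reflects-< : ∀ w π j₁ j₂ → st w ≡ π → j₁ < length π → j₂ < length π → nth π j₁ < nth π j₂ → nth w j₁ < nth w j₂
st-reflects-< w π j₁ j₂ st≡ j₁< j₂< π-ordered with nth w j₁ <? nth w j₂
... | yes w-ordered = w-ordered
... | no w-unordered = ⊥-elim (<⇒≱ π-ordered (subst₂ _≤_ (sym (nth-rank j₂ j₂<)) (sym (nth-rank j₁ j₁<)) (s≤s (countBelow-mono (≮⇒≥ w-unordered) w))))
  where
  length-w : length w ≡ length π
  length-w = trans (sym (length-map _ w)) (cong length st≡)
  nth-rank : ∀ j → j < length π → nth π j ≡ suc (countᵇ (_<ᵇ nth w j) w)
  nth-rank j j< = trans (cong (λ l → nth l j) (sym st≡)) (nth-map _ w j (subst (j <_) (sym length-w) j<))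

IsPerm-irrelevant : ∀ n σ (u v : IsPerm n σ) → u ≡ v
IsPerm-irrelevant n σ (u₁ , u₂) (v₁ , v₂) = cong₂ _,_ (uip u₁ v₁) (All.irrelevant uip u₂ v₂)

Σ-≡ : ∀ {A : Set} {B : A → Set} → (∀ x (u v : B x) → u ≡ v) → ∀ {x y} → x ≡ y → (u : B x) (v : B y) → _≡_ {A = Σ A B} (x , u) (y , v)
Σ-≡ irrelevant refl u v = cong (_ ,_) (irrelevant _ u v)

clusterCount-suc : ∀ a m k → clusterCount a m (suc k) ≡ clusterCount a m k * ((suc k * m ∸ a) C (m ∸ a))
clusterCount-suc a m k = begin
  product (map factor (oneTo (suc k)))                    ≡⟨ cong (product ∘ map factor) (oneTo-snoc k) ⟩
  product (map factor (oneTo k ++ [ suc k ]))             ≡⟨ cong product (map-++ factor (oneTo k) [ suc k ]) ⟩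
  product (map factor (oneTo k) ++ [ factor (suc k) ])    ≡⟨ product-++ (map factor (oneTo k)) [ factor (suc k) ] ⟩
  clusterCount a m k * (factor (suc k) * 1)               ≡⟨ cong (clusterCount a m k *_) (*-identityʳ _) ⟩
  clusterCount a m k * factor (suc k)                     ∎
  where
  open ≡-Reasoning
  factor : ℕ → ℕ
  factor j = (j * m ∸ a) C (m ∸ a)

module Pattern (a m : ℕ) (1≤a : 1 ≤ a) (a<m : a < m) (τ : List ℕ) (τ↭ : τ ↭ range a m) where
  p front : List ℕ
  p = pat a τ
  front = oneTo a ++ τ

  d : ℕ
  d = m ∸ a

  a≤m : a ≤ m
  a≤m = <⇒≤ a<m

  a+d≡m : a + d ≡ m
  a+d≡m = m+[n∸m]≡n a≤m

  p≡front++last : p ≡ front ++ [ suc a ]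
  p≡front++last = sym (++-assoc (oneTo a) τ [ suc a ])

  length-τ : length τ ≡ d
  length-τ = trans (↭-length τ↭) (trans (length-map _ (upTo d)) (length-upTo d))

  length-front : length front ≡ m
  length-front = trans (length-++ (oneTo a)) (trans (cong₂ _+_ (length-oneTo a) length-τ) a+d≡m)

  length-p : length p ≡ suc m
  length-p = trans (cong length p≡front++last) (trans (length-++ front) (trans (cong (_+ 1) length-front) (+-comm m 1)))

  range≡ : range a m ≡ map (λ i → suc (suc a + i)) (upTo d)
  range≡ = map-cong (λ i → trans (+-assoc a 2 i) (trans (+-suc a (suc i)) (cong suc (+-suc a i)))) (upTo d)

  τ-large : ∀ {t} → t ∈ τ → ∃ λ i → t ≡ a + suc (suc i)
  τ-large t∈τ with ∈-map⁻ _ (∈-resp-↭ τ↭ t∈τ)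
  ... | i , _ , t≡ = i , trans t≡ (+-assoc a 2 i)

  τ-above : ∀ {t} → t ∈ τ → suc (suc a) ≤ t
  τ-above t∈τ with τ-large t∈τ
  ... | i , refl = subst (suc (suc a) ≤_) (sym (trans (+-suc a (suc i)) (cong suc (+-suc a i)))) (s≤s (s≤s (m≤m+n a i)))

  p↭ : p ↭ oneTo (suc m)
  p↭ = begin
    oneTo a ++ τ ++ [ suc a ]                                   ↭⟨ ++⁺ˡ (oneTo a) (↭-sym (∷↭∷ʳ (suc a) τ)) ⟩
    oneTo a ++ suc a ∷ τ                                        ↭⟨ ++⁺ˡ (oneTo a) (prep (suc a) τ↭) ⟩
    oneTo a ++ suc a ∷ range a m                                ≡⟨ cong (oneTo a ++_) top-range ⟩
    oneTo a ++ map (λ i → suc (a + i)) (upTo (suc d))           ≡⟨ sym (oneTo-+ a (suc d)) ⟩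
    oneTo (a + suc d)                                           ≡⟨ cong oneTo (trans (+-suc a d) (cong suc a+d≡m)) ⟩
    oneTo (suc m)                                               ∎
    where
    open PermutationReasoning
    top-range : suc a ∷ range a m ≡ map (λ i → suc (a + i)) (upTo (suc d))
    top-range = cong₂ _∷_ (cong suc (sym (+-identityʳ a)))
      (trans range≡ (trans (map-cong (λ i → cong suc (sym (+-suc a i))) (upTo d)) (trans (map-∘ (upTo d)) (cong (map _) (map-upTo suc d)))))

  lowered-front↭ : oneTo a ++ map pred τ ↭ oneTo m
  lowered-front↭ = begin
    oneTo a ++ map pred τ                                       ↭⟨ ++⁺ˡ (oneTo a) (map⁺ pred τ↭) ⟩
    oneTo a ++ map pred (range a m)                             ≡⟨ cong (λ l → oneTo a ++ map pred l) range≡ ⟩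
    oneTo a ++ map pred (map (λ i → suc (suc a + i)) (upTo d))  ≡⟨ cong (oneTo a ++_) (sym (map-∘ (upTo d))) ⟩
    oneTo a ++ map (λ i → suc (a + i)) (upTo d)                 ≡⟨ sym (oneTo-+ a d) ⟩
    oneTo (a + d)                                               ≡⟨ cong oneTo a+d≡m ⟩
    oneTo m                                                     ∎
    where open PermutationReasoning

  p-head : ∃ λ q → p ≡ 1 ∷ q
  p-head with oneTo-head 1≤a
  ... | q , oneTo≡ = q ++ τ ++ [ suc a ] , cong (_++ τ ++ [ suc a ]) oneTo≡

  nth-p-low : ∀ j → j < a → nth p j ≡ suc j
  nth-p-low j j<a = trans (nth-++ˡ (oneTo a) _ j (subst (j <_) (sym (length-oneTo a)) j<a)) (nth-oneTo a j j<a)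

  nth-p-last : nth p m ≡ suc a
  nth-p-last = trans (cong₂ nth p≡front++last (sym (trans (+-identityʳ _) length-front))) (nth-++ʳ front [ suc a ] 0)

  nth-p-middle : ∀ j → a ≤ j → j < m → suc (suc a) ≤ nth p j
  nth-p-middle j a≤j j<m with m≤n⇒∃[o]m+o≡n a≤j
  ... | t , refl = subst (suc (suc a) ≤_) (sym nth-p-τ) (τ-above (nth-∈ τ t t<τ))
    where
    t<τ : t < length τ
    t<τ = subst (t <_) (sym length-τ) (+-cancelˡ-< a t d (subst (a + t <_) (sym a+d≡m) j<m))
    nth-p-τ : nth p (a + t) ≡ nth τ t
    nth-p-τ = begin
      nth (oneTo a ++ τ ++ [ suc a ]) (a + t)                   ≡⟨ cong (λ n → nth p (n + t)) (sym (length-oneTo a)) ⟩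
      nth (oneTo a ++ τ ++ [ suc a ]) (length (oneTo a) + t)    ≡⟨ nth-++ʳ (oneTo a) (τ ++ [ suc a ]) t ⟩
      nth (τ ++ [ suc a ]) t                                    ≡⟨ nth-++ˡ τ [ suc a ] t t<τ ⟩
      nth τ t                                                   ∎
      where open ≡-Reasoning

  -- p occurs in σ at the 0-based position s.
  OccursAt : List ℕ → ℕ → Set
  OccursAt σ s = st (take (length p) (drop s σ)) ≡ p

  -- (1) Two occurrences of p never start at distance δ with 0 < δ < m:
  -- writing e = m - δ and choosing y < a with a ≤ δ + y < m, the entry at
  -- δ + y of the first occurrence (entry y of the second) would be both
  -- larger and smaller than the entry at m of the first (entry e of the
  -- second), since p(m) = a+1 < p(δ+y) while p(y) = y+1 < p(e).
  no-overlap : ∀ σ s δ → 1 ≤ δ → δ < m → OccursAt σ s → OccursAt σ (s + δ) → ⊥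
  no-overlap σ s δ 1≤δ δ<m occ occ′ = <-asym second-says first-says
    where
    w w′ : List ℕ
    w = take (length p) (drop s σ)
    w′ = take (length p) (drop (s + δ) σ)
    choice : Σ ℕ λ y → y < a × a ≤ δ + y × δ + y < m
    choice with a ≤? δ
    ... | yes a≤δ = 0 , 1≤a , subst (a ≤_) (sym (+-identityʳ δ)) a≤δ , subst (_< m) (sym (+-identityʳ δ)) δ<m
    ... | no a≰δ with m≤n⇒∃[o]m+o≡n (<⇒≤ (≰⇒> a≰δ))
    ...   | y , δ+y≡a = y , subst (y <_) δ+y≡a (m<n+m y 1≤δ) , subst (a ≤_) (sym δ+y≡a) ≤-refl , subst (_< m) (sym δ+y≡a) a<m
    y = proj₁ choice
    y<a = proj₁ (proj₂ choice)
    a≤δ+y = proj₁ (proj₂ (proj₂ choice))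
    δ+y<m = proj₂ (proj₂ (proj₂ choice))
    e = proj₁ (m≤n⇒∃[o]m+o≡n (<⇒≤ δ<m))
    δ+e≡m : δ + e ≡ m
    δ+e≡m = proj₂ (m≤n⇒∃[o]m+o≡n (<⇒≤ δ<m))
    e<m : e < m
    e<m = subst (e <_) δ+e≡m (m<n+m e 1≤δ)
    y<e : y < e
    y<e = +-cancelˡ-< δ y e (subst (δ + y <_) (sym δ+e≡m) δ+y<m)
    <p : ∀ {j} → j < m → j < length p
    <p j<m = subst (_ <_) (sym length-p) (≤-trans j<m (n≤1+n m))
    shared-y : nth w (δ + y) ≡ nth w′ y
    shared-y = trans (nth-window (length p) s σ (δ + y) (<p δ+y<m))
      (trans (cong (nth σ) (sym (+-assoc s δ y))) (sym (nth-window (length p) (s + δ) σ y (<p (<-trans y<e e<m)))))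
    shared-e : nth w m ≡ nth w′ e
    shared-e = trans (nth-window (length p) s σ m (subst (m <_) (sym length-p) ≤-refl))
      (trans (cong (λ j → nth σ (s + j)) (sym δ+e≡m))
      (trans (cong (nth σ) (sym (+-assoc s δ e))) (sym (nth-window (length p) (s + δ) σ e (<p e<m)))))
    first-says : nth w′ e < nth w′ y
    first-says = subst₂ _<_ shared-e shared-y
      (st-reflects-< w p m (δ + y) occ (subst (m <_) (sym length-p) ≤-refl) (<p δ+y<m)
        (subst (_< nth p (δ + y)) (sym nth-p-last) (nth-p-middle (δ + y) a≤δ+y δ+y<m)))
    p-y<p-e : nth p y < nth p e
    p-y<p-e with e <? a
    ... | yes e<a = subst₂ _<_ (sym (nth-p-low y y<a)) (sym (nth-p-low e e<a)) (s≤s y<e)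
    ... | no e≮a = subst (_< nth p e) (sym (nth-p-low y y<a)) (≤-trans (s≤s (s≤s (<⇒≤ y<a))) (nth-p-middle e (≮⇒≥ e≮a) e<m))
    second-says : nth w′ y < nth w′ e
    second-says = st-reflects-< w′ p y e occ′ (<p (<-trans y<e e<m)) (<p e<m) p-y<p-e

  gap-is-m : ∀ σ s δ → OccursAt σ s → OccursAt σ (s + δ) → 1 ≤ δ → δ < length p → δ ≡ m
  gap-is-m σ s δ occ occ′ 1≤δ δ<p with δ <? m
  ... | yes δ<m = ⊥-elim (no-overlap σ s δ 1≤δ δ<m occ occ′)
  ... | no δ≮m = ≤-antisym (≤-pred (subst (δ <_) length-p δ<p)) (≮⇒≥ δ≮m)

  Tiled : ℕ → List ℕ → Set
  Tiled zero σ = ⊤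
  Tiled (suc k) σ = OccursAt σ 0 × Tiled k (drop m σ)

  -- The permutations that correspond to k-clusters.
  TiledPerm : ℕ → List ℕ → Set
  TiledPerm k σ = IsPerm (suc (k * m)) σ × Tiled k σ

  Tiled-irrelevant : ∀ k σ (u v : Tiled k σ) → u ≡ v
  Tiled-irrelevant zero σ tt tt = refl
  Tiled-irrelevant (suc k) σ (u₁ , u₂) (v₁ , v₂) = cong₂ _,_ (uip u₁ v₁) (Tiled-irrelevant k _ u₂ v₂)

  TiledPerm-irrelevant : ∀ k σ (u v : TiledPerm k σ) → u ≡ v
  TiledPerm-irrelevant k σ (u₁ , u₂) (v₁ , v₂) = cong₂ _,_ (IsPerm-irrelevant _ σ u₁ v₁) (Tiled-irrelevant k σ u₂ v₂)

  Tiled-map : ∀ {f} → StrictMono f → ∀ k σ → Tiled k (map f σ) ≡ Tiled k σ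
  Tiled-map f-mono zero σ = refl
  Tiled-map {f} f-mono (suc k) σ = cong₂ _×_
    (cong (_≡ p) (trans (cong st (take-map (length p) σ)) (st-map f-mono (take (length p) σ))))
    (trans (cong (Tiled k) (drop-map m σ)) (Tiled-map f-mono k (drop m σ)))

  -- (1') k-clusters are tiled permutations.  The occurrences of a cluster
  -- starting at the 1-based position i are forced to be the tiling from i.

  tiling : ℕ → ℕ → List (List ℕ × ℕ)
  tiling zero i = []
  tiling (suc k) i = (p , i) ∷ tiling k (i + m)

  length-tiling : ∀ k i → length (tiling k i) ≡ k
  length-tiling zero i = refl
  length-tiling (suc k) i = cong suc (length-tiling k (i + m))

  next-position : ∀ σ i i′ → 1 ≤ i → Occurs [ p ] σ (p , i) → Occurs [ p ] σ (p , i′) → i < i′ → i′ < i + length p → i′ ≡ i + m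
  next-position σ (suc s) i′ _ (_ , occ) (_ , occ′) i<i′ i′< with m≤n⇒∃[o]m+o≡n (<⇒≤ i<i′)
  ... | δ , refl = cong (suc s +_) (gap-is-m σ s δ occ occ′ 1≤δ (+-cancelˡ-< (suc s) δ (length p) i′<))
    where
    1≤δ : 1 ≤ δ
    1≤δ = +-cancelˡ-< (suc s) 0 δ (subst (_< suc s + δ) (sym (+-identityʳ (suc s))) i<i′)

  cluster-structure : ∀ σ π i rest n → All (Occurs [ p ] σ) ((π , i) ∷ rest) → Chain ((π , i) ∷ rest) n → 1 ≤ i →
                      ((π , i) ∷ rest ≡ tiling (suc (length rest)) i) × (n ≡ i + suc (length rest) * m)
  cluster-structure σ π i [] n ((here refl , _) ∷ []) n≡ _ = refl , (begin
    n                   ≡⟨ n≡ ⟩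
    i + length p ∸ 1    ≡⟨ cong (λ l → i + l ∸ 1) length-p ⟩
    i + suc m ∸ 1       ≡⟨ cong (_∸ 1) (+-suc i m) ⟩
    i + m               ≡⟨ cong (i +_) (sym (+-identityʳ m)) ⟩
    i + (m + 0)         ∎)
    where open ≡-Reasoning
  cluster-structure σ π i ((π′ , i′) ∷ rest) n (occ@(here refl , _) ∷ occs@(occ′@(here refl , _) ∷ _)) (i<i′ , i′< , chain) 1≤i =
    cong ((p , i) ∷_) (trans (proj₁ later) (cong (tiling (suc (length rest))) i′≡)) ,
    trans (proj₂ later) (trans (cong (_+ suc (length rest) * m) i′≡) (+-assoc i m _))
    where
    i′≡ : i′ ≡ i + m
    i′≡ = next-position σ i i′ 1≤i occ occ′ i<i′ i′<
    later = cluster-structure σ π′ i′ rest n occs chain (≤-trans 1≤i (<⇒≤ i<i′))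

  tiling-occurs⇒Tiled : ∀ σ k s → All (Occurs [ p ] σ) (tiling k (suc s)) → Tiled k (drop s σ)
  tiling-occurs⇒Tiled σ zero s _ = tt
  tiling-occurs⇒Tiled σ (suc k) s ((_ , occ) ∷ occs) = occ , subst (Tiled k) (sym (drop-drop s m σ)) (tiling-occurs⇒Tiled σ k (s + m) occs)

  Tiled⇒tiling-occurs : ∀ σ k s → Tiled k (drop s σ) → All (Occurs [ p ] σ) (tiling k (suc s))
  Tiled⇒tiling-occurs σ zero s _ = []
  Tiled⇒tiling-occurs σ (suc k) s (occ , tiled) = (here refl , occ) ∷ Tiled⇒tiling-occurs σ k (s + m) (subst (Tiled k) (drop-drop s m σ) tiled)

  tiling-chain : ∀ k i → Chain (tiling (suc k) i) (i + suc k * m)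
  tiling-chain zero i = trans (cong (i +_) (+-identityʳ m)) (sym (trans (cong (λ l → i + l ∸ 1) length-p) (cong (_∸ 1) (+-suc i m))))
  tiling-chain (suc k) i =
    subst (i <_) (+-comm m i) (m<n+m i (≤-trans 1≤a a≤m)) ,
    subst (i + m <_) (cong (i +_) (sym length-p)) (subst (suc (i + m) ≤_) (sym (+-suc i m)) ≤-refl) ,
    subst (Chain (tiling (suc k) (i + m))) (+-assoc i m _) (tiling-chain k (i + m))

  Occurs-irrelevant : ∀ σ x (u v : Occurs [ p ] σ x) → u ≡ v
  Occurs-irrelevant σ x (here u₁ , u₂) (here v₁ , v₂) = cong₂ _,_ (cong here (uip u₁ v₁)) (uip u₂ v₂)

  Chain-irrelevant : ∀ occs n (u v : Chain occs n) → u ≡ v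
  Chain-irrelevant (x ∷ []) n u v = uip u v
  Chain-irrelevant (x ∷ y ∷ occs) n (u₁ , u₂ , u₃) (v₁ , v₂ , v₃) =
    cong₂ _,_ (≤-irrelevant u₁ v₁) (cong₂ _,_ (≤-irrelevant u₂ v₂) (Chain-irrelevant (y ∷ occs) n u₃ v₃))

  StartsAt1-irrelevant : ∀ occs (u v : StartsAt1 occs) → u ≡ v
  StartsAt1-irrelevant (x ∷ occs) u v = uip u v

  module _ (k : ℕ) where
    K : ℕ
    K = suc k

    Cluster-≡ : ∀ {n n′ σ occs occs′} {perm perm′ len len′ occ occ′ start start′ chain chain′} → n ≡ n′ → occs ≡ occs′ →
      _≡_ {A = Cluster [ p ] K} (n , σ , perm , occs , len , occ , start , chain) (n′ , σ , perm′ , occs′ , len′ , occ′ , start′ , chain′)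
    Cluster-≡ {n} {σ = σ} {occs = occs} {perm = perm} {perm′} {len} {len′} {occ} {occ′} {start} {start′} {chain} {chain′} refl refl =
      cong (λ z → n , σ , z) (cong₂ _,_ (IsPerm-irrelevant n σ perm perm′) (cong (occs ,_)
        (cong₂ _,_ (uip len len′) (cong₂ _,_ (All.irrelevant (λ {x} → Occurs-irrelevant σ x) occ occ′)
          (cong₂ _,_ (StartsAt1-irrelevant occs start start′) (Chain-irrelevant occs n chain chain′))))))

    normal-form : ∀ {n σ occs} → length occs ≡ K → All (Occurs [ p ] σ) occs → StartsAt1 occs → Chain occs n →
                  (occs ≡ tiling K 1) × (n ≡ suc (K * m))
    normal-form {n} {σ} {(π , 1) ∷ rest} refl occs refl chain = cluster-structure σ π 1 rest n occs chain ≤-refl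

    Cluster↔TiledPerm : Cluster [ p ] K ↔ Σ (List ℕ) (TiledPerm K)
    Cluster↔TiledPerm = mk↔ₛ′ to from to∘from from∘to
      where
      to : Cluster [ p ] K → Σ (List ℕ) (TiledPerm K)
      to (n , σ , perm , occs , len , occ , start , chain) =
        σ , subst (λ n → IsPerm n σ) (proj₂ nf) perm , tiling-occurs⇒Tiled σ K 0 (subst (All (Occurs [ p ] σ)) (proj₁ nf) occ)
        where nf = normal-form len occ start chain
      from : Σ (List ℕ) (TiledPerm K) → Cluster [ p ] K
      from (σ , perm , tiled) = suc (K * m) , σ , perm , tiling K 1 , length-tiling K 1 , Tiled⇒tiling-occurs σ K 0 tiled , refl , tiling-chain k 1
      to∘from : ∀ y → to (from y) ≡ y
      to∘from (σ , g) = Σ-≡ (TiledPerm-irrelevant K) refl _ _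
      from∘to : ∀ x → from (to x) ≡ x
      from∘to (n , σ , perm , occs , len , occ , start , chain) = Cluster-≡ (sym (proj₂ nf)) (sym (proj₁ nf))
        where nf = normal-form len occ start chain

  -- An occurrence of p starts with its smallest entry, since p starts with 1.
  occurrence-head-min : ∀ h w → st (h ∷ w) ≡ p → ∀ {y} → y ∈ h ∷ w → h ≤ y
  occurrence-head-min h w st≡p {y} y∈ = ≮⇒≥ (λ y<h → true≢false (trans (sym (<⇒<ᵇ y<h)) (count≡0⇒false (_<ᵇ h) (h ∷ w) none-below y∈)))
    where
    none-below : countᵇ (_<ᵇ h) (h ∷ w) ≡ 0
    none-below = suc-injective (∷-injectiveˡ (trans st≡p (proj₂ p-head)))

  length-drop-m : ∀ k (σ : List ℕ) → length σ ≡ suc (suc k * m) → length (drop m σ) ≡ suc (k * m)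
  length-drop-m k σ len = trans (length-drop m σ) (trans (cong (_∸ m) (trans len (sym (+-suc m (k * m))))) (m+n∸m≡n m (suc (k * m))))

  -- In a tiled sequence the first entry is the smallest: each occurrence
  -- starts with its minimum, and its last entry starts the next occurrence.
  tiled-head-min : ∀ k h t → Tiled k (h ∷ t) → length (h ∷ t) ≡ suc (k * m) → ∀ {y} → y ∈ h ∷ t → h ≤ y
  tiled-head-min zero h [] _ _ (here refl) = ≤-refl
  tiled-head-min (suc k) h t (occ , tiled) len {y} y∈ with drop m (h ∷ t) in rest≡
  ... | [] = ⊥-elim (1+n≢0 (sym (trans (sym (cong length rest≡)) (length-drop-m k (h ∷ t) len))))
  ... | h′ ∷ t′ = [ first-min ∘ in-window ∘ ∈-++⁺ˡ , ≤-trans h≤h′ ∘ rest-min ∘ subst (y ∈_) rest≡ ]′ (∈-take⊎drop m (h ∷ t) y∈)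
    where
    window≡ : take (suc m) (h ∷ t) ≡ take m (h ∷ t) ++ [ h′ ]
    window≡ = trans (take-suc m (h ∷ t)) (cong (λ l → take m (h ∷ t) ++ take 1 l) rest≡)
    in-window : ∀ {z} → z ∈ take m (h ∷ t) ++ [ h′ ] → z ∈ take (suc m) (h ∷ t)
    in-window = subst (_ ∈_) (sym window≡)
    first-min : ∀ {z} → z ∈ take (suc m) (h ∷ t) → h ≤ z
    first-min = occurrence-head-min h (take m t) (subst (λ n → st (take n (h ∷ t)) ≡ p) length-p occ)
    h≤h′ : h ≤ h′
    h≤h′ = first-min (in-window (∈-++⁺ʳ (take m (h ∷ t)) (here refl)))
    rest-min : ∀ {z} → z ∈ h′ ∷ t′ → h′ ≤ z
    rest-min = tiled-head-min k h′ t′ tiled (trans (cong length (sym rest≡)) (length-drop-m k (h ∷ t) len))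

  tiled-starts-with-1 : ∀ k σ → TiledPerm k σ → ∃ λ t → σ ≡ 1 ∷ t
  tiled-starts-with-1 k (h ∷ t) (perm , tiled) = t , cong (_∷ t) (≤-antisym h≤1 1≤h)
    where
    σ↭ = IsPerm⇒↭ _ _ perm
    h≤1 : h ≤ 1
    h≤1 = tiled-head-min k h t tiled (proj₁ perm) (∈-resp-↭ (↭-sym σ↭) (∈-oneTo⁺ {suc (k * m)} (s≤s z≤n) (s≤s z≤n)))
    1≤h : 1 ≤ h
    1≤h = proj₁ (∈-oneTo⁻ (∈-resp-↭ σ↭ (here refl)))

  -- A tiled permutation of length N = (k+1)m+1 is glued
  -- from a bit string b of length M = (k+1)m-a with d true bits and a tiled
  -- permutation σ′ of length N′ = km+1: its first m entries are the chosen
  -- positions of αCode b = 1^a 0 b and the rest is σ′ relabelled onto the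
  -- unchosen positions.  The first window front ++ [a+1] is p relabelled by
  -- select (windowCode b), with windowCode b = 1^a 1 b.
  module Step (k : ℕ) where
    N N′ M : ℕ
    N = suc (suc k * m)
    N′ = suc (k * m)
    M = suc k * m ∸ a

    αCode windowCode : List Bool → List Bool
    αCode b = replicate a true ++ false ∷ b
    windowCode b = replicate a true ++ true ∷ b

    glued-front : List Bool → List ℕ
    glued-front b = map (select (windowCode b)) front

    glue : List ℕ → List Bool → List ℕ
    glue σ′ b = glued-front b ++ map (select (complement (αCode b))) σ′

    a≤N-1 : a ≤ suc k * m
    a≤N-1 = ≤-trans a≤m (m≤m+n m (k * m))

    -- On 1 … a both codes select the identity; above, windowCode is αCode shifted by one.
    glued-front≡ : ∀ b → glued-front b ≡ map (select (αCode b)) (oneTo a ++ map pred τ)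
    glued-front≡ b = trans (map-++ (select (windowCode b)) (oneTo a) τ)
      (trans (cong₂ _++_ on-low on-τ) (sym (map-++ (select (αCode b)) (oneTo a) (map pred τ))))
      where
      on-low : map (select (windowCode b)) (oneTo a) ≡ map (select (αCode b)) (oneTo a)
      on-low = map-cong-local (All.tabulate λ {x} x∈ → let x≤a = proj₂ (∈-oneTo⁻ x∈) in
        trans (select-within-trues a _ x x≤a) (sym (select-within-trues a _ x x≤a)))
      on-large : ∀ t → (∃ λ i → t ≡ a + suc (suc i)) → select (windowCode b) t ≡ select (αCode b) (pred t)
      on-large t (i , refl) = begin
        select (windowCode b) (a + suc (suc i))   ≡⟨ select-after-trues a (true ∷ b) (suc (suc i)) ⟩
        a + select (true ∷ b) (suc (suc i))       ≡⟨ sym (select-after-trues a (false ∷ b) (suc i)) ⟩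
        select (αCode b) (a + suc i)              ≡⟨ cong (select (αCode b) ∘ pred) (sym (+-suc a (suc i))) ⟩
        select (αCode b) (pred (a + suc (suc i))) ∎
        where open ≡-Reasoning
      on-τ : map (select (windowCode b)) τ ≡ map (select (αCode b)) (map pred τ)
      on-τ = trans (map-cong-local (All.tabulate λ {t} t∈τ → on-large t (τ-large t∈τ))) (map-∘ τ)

    select-unchosen-1 : ∀ b → select (complement (αCode b)) 1 ≡ suc a
    select-unchosen-1 b = trans (cong (λ l → select l 1) (complement-after-trues a false b))
      (trans (select-after-falses a (true ∷ complement b) 0) (+-comm a 1))

    select-window-a+1 : ∀ b → select (windowCode b) (suc a) ≡ suc a
    select-window-a+1 b = trans (cong (select (windowCode b)) (+-comm 1 a)) (trans (select-after-trues a (true ∷ b) 1) (+-comm a 1))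

    trues-αCode : ∀ b → trues b ≡ d → trues (αCode b) ≡ m
    trues-αCode b t≡d = trans (trues-after-trues a (false ∷ b)) (trans (cong (a +_) t≡d) a+d≡m)

    length-αCode : ∀ b → length b ≡ M → length (αCode b) ≡ N
    length-αCode b len = trans (length-++ (replicate a true))
      (trans (cong₂ _+_ (length-replicate a) (cong suc len)) (trans (+-suc a M) (cong suc (m+[n∸m]≡n a≤N-1))))

    trues-complement-αCode : ∀ b → length b ≡ M → trues b ≡ d → trues (complement (αCode b)) ≡ N′
    trues-complement-αCode b len t≡d = +-cancelˡ-≡ m _ _ (begin
      m + trues (complement (αCode b))                ≡⟨ cong (_+ _) (sym (trues-αCode b t≡d)) ⟩
      trues (αCode b) + trues (complement (αCode b))  ≡⟨ trues-complement (αCode b) ⟩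
      length (αCode b)                                ≡⟨ length-αCode b len ⟩
      suc (m + k * m)                                 ≡⟨ sym (+-suc m (k * m)) ⟩
      m + N′                                          ∎)
      where open ≡-Reasoning

    length-glued-front : ∀ b → length (glued-front b) ≡ m
    length-glued-front b = trans (length-map _ front) length-front

    glued-front↭ : ∀ b → trues b ≡ d → glued-front b ↭ chosen (αCode b)
    glued-front↭ b t≡d = begin
      glued-front b                                          ≡⟨ glued-front≡ b ⟩
      map (select (αCode b)) (oneTo a ++ map pred τ)         ↭⟨ map⁺ (select (αCode b)) lowered-front↭ ⟩
      map (select (αCode b)) (oneTo m)                       ≡⟨ cong (λ n → map (select (αCode b)) (oneTo n)) (sym (trues-αCode b t≡d)) ⟩
      chosen (αCode b)                                       ∎
      where open PermutationReasoning

    glue-TiledPerm : ∀ σ′ b → TiledPerm k σ′ → length b ≡ M → trues b ≡ d → TiledPerm (suc k) (glue σ′ b)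
    glue-TiledPerm σ′ b (perm′ , tiled′) len t≡d = ↭⇒IsPerm N _ glue↭ , first-occurrence , rest-tiled
      where
      unchosen : ℕ → ℕ
      unchosen = select (complement (αCode b))
      glue↭ : glue σ′ b ↭ oneTo N
      glue↭ = begin
        glued-front b ++ map unchosen σ′                     ↭⟨ ++⁺ (glued-front↭ b t≡d) (map⁺ unchosen (IsPerm⇒↭ N′ σ′ perm′)) ⟩
        chosen (αCode b) ++ map unchosen (oneTo N′)          ≡⟨ cong (λ n → chosen (αCode b) ++ map unchosen (oneTo n)) (sym (trues-complement-αCode b len t≡d)) ⟩
        chosen (αCode b) ++ chosen (complement (αCode b))    ↭⟨ chosen-partition (αCode b) ⟩
        oneTo (length (αCode b))                             ≡⟨ cong oneTo (length-αCode b len) ⟩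
        oneTo N                                              ∎
        where open PermutationReasoning
      -- σ′ starts with 1, which is relabelled to a+1.
      first-window : take (length p) (glue σ′ b) ≡ map (select (windowCode b)) p
      first-window with tiled-starts-with-1 k σ′ (perm′ , tiled′)
      ... | t , refl = begin
        take (length p) (glue σ′ b)                        ≡⟨ cong (λ n → take n (glue σ′ b)) length-p ⟩
        take (suc m) (glue σ′ b)                           ≡⟨ take-suc-++ (glued-front b) (map unchosen (1 ∷ t)) (length-glued-front b) ⟩
        glued-front b ++ [ unchosen 1 ]                    ≡⟨ cong (λ z → glued-front b ++ [ z ]) (trans (select-unchosen-1 b) (sym (select-window-a+1 b))) ⟩
        glued-front b ++ [ select (windowCode b) (suc a) ] ≡⟨ sym (map-++ (select (windowCode b)) front [ suc a ]) ⟩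
        map (select (windowCode b)) (front ++ [ suc a ])   ≡⟨ cong (map (select (windowCode b))) (sym p≡front++last) ⟩
        map (select (windowCode b)) p                      ∎
        where open ≡-Reasoning
      first-occurrence : OccursAt (glue σ′ b) 0
      first-occurrence = trans (cong st first-window) (trans (st-map (select-mono (windowCode b)) p) (st-id p↭))
      rest-tiled : Tiled k (drop m (glue σ′ b))
      rest-tiled = subst (Tiled k) (sym (drop-++-length (glued-front b) _ (length-glued-front b)))
        (subst id (sym (Tiled-map (select-mono (complement (αCode b))) k σ′)) tiled′)

    -- Conversely every tiled permutation σ of length N is glued from
    -- σ′ = st (drop m σ) and the bit string b₀ read off from α = take m σ.
    module Decompose (σ : List ℕ) (tp : TiledPerm (suc k) σ) where
      perm = proj₁ tp
      first = proj₁ (proj₂ tp)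
      rest = proj₂ (proj₂ tp)

      σ↭ : σ ↭ oneTo N
      σ↭ = IsPerm⇒↭ N σ perm

      α β : List ℕ
      α = take m σ
      β = drop m σ

      α++β≡σ : α ++ β ≡ σ
      α++β≡σ = take++drop≡id m σ

      length-α : length α ≡ m
      length-α = trans (length-take m σ) (trans (cong (m ⊓_) (proj₁ perm)) (m≤n⇒m⊓n≡m (≤-trans (m≤m+n m (k * m)) (n≤1+n _))))

      length-β : length β ≡ N′
      length-β = length-drop-m k σ (proj₁ perm)

      disjoint : ∀ {x} → x ∈ α → x ∈ β → ⊥
      disjoint = IsPerm-disjoint N α β (subst (IsPerm N) (sym α++β≡σ) perm)

      open Partition N α β (subst (_↭ oneTo N) (sym α++β≡σ) σ↭) disjoint using (inα; indicator; length-indicator; α↭chosen; β↭unchosen)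

      -- The first entry x of β closes the first occurrence and is the minimum of β.
      β-head : ∃₂ λ x β′ → β ≡ x ∷ β′
      β-head with β | length-β
      ... | x ∷ β′ | _ = x , β′ , refl
      x = proj₁ β-head
      β′ = proj₁ (proj₂ β-head)
      β≡ : β ≡ x ∷ β′
      β≡ = proj₂ (proj₂ β-head)

      x∈β : x ∈ β
      x∈β = subst (x ∈_) (sym β≡) (here refl)

      x-min : ∀ {y} → y ∈ β → x ≤ y
      x-min y∈β = tiled-head-min k x β′ (subst (Tiled k) β≡ rest) (trans (cong length (sym β≡)) length-β) (subst (_ ∈_) β≡ y∈β)

      first-window : st (α ++ [ x ]) ≡ p
      first-window = trans (cong st (sym window≡)) (subst (λ n → st (take n σ) ≡ p) length-p first)
        where
        window≡ : take (suc m) σ ≡ α ++ [ x ]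
        window≡ = trans (take-suc m σ) (cong (λ l → α ++ take 1 l) β≡)

      -- x = a+1: in the first window a entries lie below x, and none in β.
      below-x-in-α : countᵇ (_<ᵇ x) α ≡ a
      below-x-in-α = begin
        countᵇ (_<ᵇ x) α                              ≡⟨ sym (+-identityʳ _) ⟩
        countᵇ (_<ᵇ x) α + 0                          ≡⟨ cong (countᵇ (_<ᵇ x) α +_) (sym (all-false⇒count≡0 (_<ᵇ x) [ x ] (≥⇒<ᵇ-false {x} ≤-refl ∷ []))) ⟩
        countᵇ (_<ᵇ x) α + countᵇ (_<ᵇ x) [ x ]       ≡⟨ sym (count-++ (_<ᵇ x) α [ x ]) ⟩
        countᵇ (_<ᵇ x) (α ++ [ x ])                   ≡⟨ suc-injective rank-x ⟩
        a                                             ∎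
        where
        open ≡-Reasoning
        rank-x : suc (countᵇ (_<ᵇ x) (α ++ [ x ])) ≡ suc a
        rank-x = proj₂ (∷ʳ-injective (map _ α) front (trans (sym (map-++ _ α [ x ])) (trans first-window p≡front++last)))

      below-x : countᵇ (_<ᵇ x) (oneTo N) ≡ a
      below-x = begin
        countᵇ (_<ᵇ x) (oneTo N)                ≡⟨ sym (count-↭ (_<ᵇ x) σ↭) ⟩
        countᵇ (_<ᵇ x) σ                        ≡⟨ cong (countᵇ (_<ᵇ x)) (sym α++β≡σ) ⟩
        countᵇ (_<ᵇ x) (α ++ β)                 ≡⟨ count-++ (_<ᵇ x) α β ⟩
        countᵇ (_<ᵇ x) α + countᵇ (_<ᵇ x) β     ≡⟨ cong₂ _+_ below-x-in-α (all-false⇒count≡0 _ β (All.tabulate (≥⇒<ᵇ-false ∘ x-min))) ⟩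
        a + 0                                   ≡⟨ +-identityʳ a ⟩
        a                                       ∎
        where open ≡-Reasoning

      x≡a+1 : x ≡ suc a
      x≡a+1 = trans (sym (rank-oneTo (∈-resp-↭ σ↭ (subst (x ∈_) α++β≡σ (∈-++⁺ʳ α x∈β))))) (cong suc below-x)

      -- Hence α contains 1, …, a but not a+1: its indicator is αCode b₀.
      low∈α : ∀ {v} → v ∈ oneTo a → inα v ≡ true
      low∈α {v} v∈ with ∈-++⁻ α (subst (v ∈_) (sym α++β≡σ) (∈-resp-↭ (↭-sym σ↭) (∈-oneTo⁺ 1≤v (≤-trans v≤a (≤-trans a≤N-1 (n≤1+n _))))))
        where
        1≤v = proj₁ (∈-oneTo⁻ v∈)
        v≤a = proj₂ (∈-oneTo⁻ v∈)
      ... | inj₁ v∈α = ∈⇒memberᵇ v∈α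
      ... | inj₂ v∈β = ⊥-elim (<-irrefl refl (≤-trans (subst (_≤ v) x≡a+1 (x-min v∈β)) (proj₂ (∈-oneTo⁻ v∈))))

      a+1∉α : inα (suc a) ≡ false
      a+1∉α = ∉⇒memberᵇ (λ a+1∈α → disjoint a+1∈α (subst (_∈ β) x≡a+1 x∈β))

      b₀ : List Bool
      b₀ = drop (suc a) indicator

      indicator≡ : indicator ≡ αCode b₀
      indicator≡ = trans (sym (take++drop≡id (suc a) indicator)) (trans (cong (_++ b₀) prefix≡) (++-assoc (replicate a true) [ false ] b₀))
        where
        prefix≡ : take (suc a) indicator ≡ replicate a true ++ [ false ]
        prefix≡ = begin
          take (suc a) (map inα (oneTo N))                   ≡⟨ take-map (suc a) (oneTo N) ⟩
          map inα (take (suc a) (oneTo N))                   ≡⟨ cong (λ n → map inα (take (suc a) (oneTo n))) (sym (m+[n∸m]≡n {suc a} {N} (s≤s a≤N-1))) ⟩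
          map inα (take (suc a) (oneTo (suc a + M)))         ≡⟨ cong (map inα) (take-oneTo (suc a) M) ⟩
          map inα (oneTo (suc a))                            ≡⟨ cong (map inα) (oneTo-snoc a) ⟩
          map inα (oneTo a ++ [ suc a ])                     ≡⟨ map-++ inα (oneTo a) [ suc a ] ⟩
          map inα (oneTo a) ++ [ inα (suc a) ]              ≡⟨ cong₂ (λ l z → l ++ [ z ]) (map-all-true inα (oneTo a) (All.tabulate low∈α)) a+1∉α ⟩
          replicate (length (oneTo a)) true ++ [ false ]      ≡⟨ cong (λ n → replicate n true ++ [ false ]) (length-oneTo a) ⟩
          replicate a true ++ [ false ]                       ∎
          where open ≡-Reasoning

      length-b₀ : length b₀ ≡ M
      length-b₀ = trans (length-drop (suc a) indicator) (cong (_∸ suc a) length-indicator)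

      trues-b₀ : trues b₀ ≡ d
      trues-b₀ = +-cancelˡ-≡ a _ _ (begin
        a + trues b₀            ≡⟨ sym (trues-after-trues a (false ∷ b₀)) ⟩
        trues (αCode b₀)        ≡⟨ cong trues (sym indicator≡) ⟩
        trues indicator         ≡⟨ sym (trans (length-map _ (oneTo (trues indicator))) (length-oneTo _)) ⟩
        length (chosen indicator) ≡⟨ sym (↭-length α↭chosen) ⟩
        length α                ≡⟨ length-α ⟩
        m                       ≡⟨ sym a+d≡m ⟩
        a + d                   ∎)
        where open ≡-Reasoning

      unchosen : ℕ → ℕ
      unchosen = select (complement indicator)

      σ′ : List ℕ
      σ′ = st β

      relabel-σ′ : map unchosen σ′ ≡ β
      relabel-σ′ = st-relabel (select-mono (complement indicator)) β↭unchosen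

      σ′-TiledPerm : TiledPerm k σ′
      σ′-TiledPerm = ↭⇒IsPerm N′ σ′ (subst (λ n → σ′ ↭ oneTo n) trues≡N′ (st-↭ (select-mono (complement indicator)) β↭unchosen)) ,
                     subst id (Tiled-map (select-mono (complement indicator)) k σ′) (subst (Tiled k) (sym relabel-σ′) rest)
        where
        trues≡N′ : trues (complement indicator) ≡ N′
        trues≡N′ = trans (cong (trues ∘ complement) indicator≡) (trues-complement-αCode b₀ length-b₀ trues-b₀)

      window↭ : α ++ [ x ] ↭ map (select (windowCode b₀)) (oneTo (suc m))
      window↭ = begin
        α ++ [ x ]                                           ↭⟨ ++⁺ʳ [ x ] (↭-trans α↭chosen (≡⇒↭ (cong chosen indicator≡))) ⟩
        chosen (αCode b₀) ++ [ x ]                           ↭⟨ ++⁺ʳ [ x ] (↭-sym (glued-front↭ b₀ trues-b₀)) ⟩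
        glued-front b₀ ++ [ x ]                              ≡⟨ cong (λ z → glued-front b₀ ++ [ z ]) (trans x≡a+1 (sym (select-window-a+1 b₀))) ⟩
        glued-front b₀ ++ [ select (windowCode b₀) (suc a) ] ≡⟨ sym (map-++ (select (windowCode b₀)) front [ suc a ]) ⟩
        map (select (windowCode b₀)) (front ++ [ suc a ])    ≡⟨ cong (map (select (windowCode b₀))) (sym p≡front++last) ⟩
        map (select (windowCode b₀)) p                       ↭⟨ map⁺ (select (windowCode b₀)) p↭ ⟩
        map (select (windowCode b₀)) (oneTo (suc m))         ∎
        where open PermutationReasoning

      glued-front≡α : glued-front b₀ ≡ α
      glued-front≡α = begin
        map (select (windowCode b₀)) front                        ≡⟨ cong (map _) (sym (take-++-length front [ suc a ] length-front)) ⟩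
        map (select (windowCode b₀)) (take m (front ++ [ suc a ])) ≡⟨ cong (map (select (windowCode b₀)) ∘ take m) (sym p≡front++last) ⟩
        map (select (windowCode b₀)) (take m p)                   ≡⟨ sym (take-map m p) ⟩
        take m (map (select (windowCode b₀)) p)                   ≡⟨ cong (take m ∘ map (select (windowCode b₀))) (sym first-window) ⟩
        take m (map (select (windowCode b₀)) (st (α ++ [ x ])))   ≡⟨ cong (take m) (st-relabel (select-mono (windowCode b₀)) window↭) ⟩
        take m (α ++ [ x ])                                       ≡⟨ take-++-length α [ x ] length-α ⟩
        α                                                         ∎
        where open ≡-Reasoning

      glue≡σ : glue σ′ b₀ ≡ σ
      glue≡σ = trans (cong₂ _++_ glued-front≡α (trans (cong (λ c → map (select (complement c)) σ′) (sym indicator≡)) relabel-σ′)) α++β≡σ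

    module Regain (σ′ : List ℕ) (b : List Bool) (tp′ : TiledPerm k σ′) (len : length b ≡ M) (t≡d : trues b ≡ d) where
      open Decompose (glue σ′ b) (glue-TiledPerm σ′ b tp′ len t≡d) using () renaming (σ′ to σ″; b₀ to b′)

      take-glue : take m (glue σ′ b) ≡ glued-front b
      take-glue = take-++-length (glued-front b) _ (length-glued-front b)

      drop-glue : drop m (glue σ′ b) ≡ map (select (complement (αCode b))) σ′
      drop-glue = drop-++-length (glued-front b) _ (length-glued-front b)

      σ′-regained : σ″ ≡ σ′
      σ′-regained = begin
        st (drop m (glue σ′ b))                          ≡⟨ cong st drop-glue ⟩
        st (map (select (complement (αCode b))) σ′)      ≡⟨ st-map (select-mono (complement (αCode b))) σ′ ⟩
        st σ′                                            ≡⟨ st-id (IsPerm⇒↭ N′ σ′ (proj₁ tp′)) ⟩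
        σ′                                               ∎
        where open ≡-Reasoning

      b-regained : b′ ≡ b
      b-regained = trans (cong (drop (suc a)) indicator≡αCode) (drop-after-trues a false b)
        where
        in-front≡bit : ∀ {v} → v ∈ oneTo N → memberᵇ v (take m (glue σ′ b)) ≡ bit (αCode b) v
        in-front≡bit {v} v∈ = trans (cong (memberᵇ v) take-glue) (trans (memberᵇ-↭ v (glued-front↭ b t≡d))
          (memberᵇ-chosen (αCode b) v (proj₁ (∈-oneTo⁻ v∈)) (subst (v ≤_) (sym (length-αCode b len)) (proj₂ (∈-oneTo⁻ v∈)))))
        indicator≡αCode : map (λ v → memberᵇ v (take m (glue σ′ b))) (oneTo N) ≡ αCode b
        indicator≡αCode = begin
          map (λ v → memberᵇ v (take m (glue σ′ b))) (oneTo N)   ≡⟨ map-cong-local (All.tabulate in-front≡bit) ⟩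
          map (bit (αCode b)) (oneTo N)                          ≡⟨ cong (λ n → map (bit (αCode b)) (oneTo n)) (sym (length-αCode b len)) ⟩
          map (bit (αCode b)) (oneTo (length (αCode b)))         ≡⟨ indicator-bit (αCode b) ⟩
          αCode b                                                ∎
          where open ≡-Reasoning

    TiledPerm-step : Σ (List ℕ) (TiledPerm (suc k)) ↔ (Σ (List ℕ) (TiledPerm k) × Bits M d)
    TiledPerm-step = mk↔ₛ′ to from to∘from from∘to
      where
      to : Σ (List ℕ) (TiledPerm (suc k)) → Σ (List ℕ) (TiledPerm k) × Bits M d
      to (σ , tp) = (σ′ , σ′-TiledPerm) , (b₀ , length-b₀ , trues-b₀)
        where open Decompose σ tp
      from : Σ (List ℕ) (TiledPerm k) × Bits M d → Σ (List ℕ) (TiledPerm (suc k))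
      from ((σ′ , tp′) , (b , len , t≡d)) = glue σ′ b , glue-TiledPerm σ′ b tp′ len t≡d
      to∘from : ∀ y → to (from y) ≡ y
      to∘from ((σ′ , tp′) , (b , len , t≡d)) = cong₂ _,_ (Σ-≡ (TiledPerm-irrelevant k) σ′-regained _ _) (Bits-≡ b-regained)
        where open Regain σ′ b tp′ len t≡d
      from∘to : ∀ x → from (to x) ≡ x
      from∘to (σ , tp) = Σ-≡ (TiledPerm-irrelevant (suc k)) glue≡σ _ _
        where open Decompose σ tp

  TiledPerm-zero : Σ (List ℕ) (TiledPerm 0) ↔ Fin 1
  TiledPerm-zero = mk↔ₛ′ (λ _ → fzero) (λ _ → [ 1 ] , ↭⇒IsPerm 1 [ 1 ] ↭-refl , tt) (λ { fzero → refl ; (fsuc ()) })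
    (λ { (σ , tp) → Σ-≡ (TiledPerm-irrelevant 0) (sym (↭-singleton-inv (IsPerm⇒↭ 1 σ (proj₁ tp)))) _ _ })

  TiledPerm↔count : ∀ k → Σ (List ℕ) (TiledPerm k) ↔ Fin (clusterCount a m k)
  TiledPerm↔count zero = TiledPerm-zero
  TiledPerm↔count (suc k) =
    ↔-trans (Step.TiledPerm-step k)
    (↔-trans (TiledPerm↔count k ×-↔ Bits↔binomial (suc k * m ∸ a) d)
    (↔-trans (↔-sym *↔×) (Fin-≡ (sym (clusterCount-suc a m k)))))

mainTheorem2 : (a m : ℕ) → 1 ≤ a → a < m → (τ : List ℕ) → τ ↭ range a m →
                 (k : ℕ) → 1 ≤ k → Cluster [ pat a τ ] k ↔ Fin (clusterCount a m k)
mainTheorem2 a m 1≤a a<m τ τ↭ (suc k) _ = ↔-trans (Cluster↔TiledPerm k) (TiledPerm↔count (suc k))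
  where open Pattern a m 1≤a a<m τ τ↭
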